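{- Let $n\ge2$, $r\in[n]$ and $k\in[n-1]$. The map $T\mapsto(\phi_{glo}(T),\psi(T))$ is a bijection from $\mathcal{T}^{(r)}_{n,k}$ to $\Pi^{(r)}_{n,k}\times\mathcal{S}^{(r)}_{n,k}$. Moreover, the global indegree sequence of $T$ equals the type of $\phi_{glo}(T)$.
   Context: Consider a labeled tree on $[n]=\{1,\dots,n\}$ rooted at $r$, with edges oriented towards the root. - A vertex is a leaf if it has no children. - The child-group $G_v$ of a vertex $v$ is the set of its children. - A leaf-group is a nonempty child-group all of whose members are leaves. - Leaf-groups are totally ordered by comparing their maximal elements. $\mathcal{T}^{(r)}_{n,k}$ is the set of labeled trees on $[n]$ rooted at $r$ having exactly $k$ nonempty child-groups. $\phi_{glo}(T)$ is the set of nonempty child-groups of $T$; it is a set partition of $[n]\setminus\{r\}$. $\psi(T)$ is defined as follows. Put $T_0=T$. For $i=1,\dots,k$, let $L_i$ be the largest leaf-group of $T_{i-1}$, let $p_i$ be the parent of the vertices of $L_i$ in $T_{i-1}$, and let $T_i$ be obtained from $T_{i-1}$ by deleting the vertices of $L_i$ and their edges. Then $\psi(T)=(p_1,\dots,p_k)$. $\Pi^{(r)}_{n,k}$ is the set of set partitions of $[n]\setminus\{r\}$ into $k$ blocks. $\mathcal{S}^{(r)}_{n,k}$ is the set of sequences $(p_1,\dots,p_k)$ of $k$ distinct elements of $[n]$ with $p_k=r$. The global indegree sequence of $T$ is the integer partition $1^{e_1}2^{e_2}\cdots$, where $e_i$ is the number of vertices with exactly $i$ children. The type of a set partition is the integer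 partition $1^{e_1}2^{e_2}\cdots$, where $e_i$ is the number of blocks of size $i$. -}

module Defs where

open import Data.Nat as ℕ using (ℕ; zero; suc; _≤_; _<_; _⊔_)
open import Data.Bool using (Bool; true; false; _∧_; _∨_; not; if_then_else_)
open import Data.Fin using (Fin; toℕ; _≟_)
open import Data.Fin.Subset using (Subset; _∈_; _∉_; _∩_; ∣_∣; Nonempty; Empty)
open import Data.List using (List; []; _∷_; length; filter; map; foldr; allFin)
open import Data.Bool.ListAction using (any; all)
open import Data.List.Relation.Unary.All using (All)
open import Data.List.Relation.Unary.Any using (Any)
open import Data.List.Relation.Unary.AllPairs using (AllPairs)
open import Data.List.Relation.Binary.Permutation.Propositional using (_↭_)
open import Data.List.Relation.Unary.Unique.Propositional using (Unique)
open import Data.Maybe using (Maybe; just; nothing)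
open import Data.Vec as Vec using (Vec; []; _∷_; tabulate; lookup; toList)
open import Data.Product using (Σ; ∃; _×_; _,_)
open import Relation.Binary.PropositionalEquality using (_≡_; _≢_)
open import Relation.Nullary.Decidable using (⌊_⌋)
open import Relation.Nullary using (¬_)

iter : ∀ {A : Set} → (A → A) → ℕ → A → A
iter f zero    x = x
iter f (suc m) x = iter f m (f x)

-- A labeled tree on [n] = Fin n rooted at r, given by its parent map
-- (edges oriented towards the root).  The root is the unique fixed point:
-- par r ≡ r, and every vertex reaches r by following parents
-- (n steps always suffice); this excludes cycles.
record RTree (n : ℕ) (r : Fin n) : Set where
  field
    par    : Fin n → Fin n
    parRoot : par r ≡ r
    reach  : ∀ v → iter par n v ≡ r
open RTree public

module _ {n : ℕ} {r : Fin n} (T : RTree n r) where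

  isChildB : Fin n → Fin n → Bool
  isChildB u v = not ⌊ u ≟ r ⌋ ∧ ⌊ par T u ≟ v ⌋

  childGroup : Fin n → Subset n
  childGroup v = tabulate (λ u → isChildB u v)

  nonemptyB : Subset n → Bool
  nonemptyB B = any (λ u → lookup B u) (allFin n)

  phiGlo : List (Subset n)
  phiGlo = filter (λ B → Data.Bool._≟_ (nonemptyB B) true) (map childGroup (allFin n))

  -- ψ(T).  The current tree T_{i-1} is described by its set A of
  -- remaining vertices (the parent map is inherited from T).
  childIn : Subset n → Fin n → Fin n → Bool
  childIn A v u = lookup A u ∧ lookup A v ∧ isChildB u v

  hasChildIn : Subset n → Fin n → Bool
  hasChildIn A v = any (childIn A v) (allFin n)

  leafIn : Subset n → Fin n → Bool
  leafIn A u = lookup A u ∧ not (hasChildIn A u)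

  leafGroupAt : Subset n → Fin n → Bool
  leafGroupAt A v = hasChildIn A v ∧ all (λ u → not (childIn A v u) ∨ leafIn A u) (allFin n)

  -- 1 + (maximal element) of the child-group of v in T_A (0 if empty)
  maxChild : Subset n → Fin n → ℕ
  maxChild A v = foldr (λ u m → if childIn A v u then suc (toℕ u) ⊔ m else m) 0 (allFin n)

  -- the parent of the largest leaf-group (leaf-groups ordered by maximal element)
  largestLGParent : Subset n → Maybe (Fin n)
  largestLGParent A = foldr pick nothing (allFin n)
    where
    pick : Fin n → Maybe (Fin n) → Maybe (Fin n)
    pick v best with leafGroupAt A v
    ... | false = best
    ... | true with best
    ...   | nothing = just v
    ...   | just w  = if ⌊ maxChild A w ℕ.<? maxChild A v ⌋ then just v else just w

  deleteGroup : Subset n → Fin n → Subset n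
  deleteGroup A p = tabulate (λ u → lookup A u ∧ not (childIn A p u))

  -- k steps of the procedure (if no leaf-group exists, which does not happen
  -- for T ∈ 𝒯_{n,k}, the step outputs r and leaves the tree unchanged)
  psiFrom : (k : ℕ) → Subset n → Vec (Fin n) k
  psiFrom zero    A = []
  psiFrom (suc k) A with largestLGParent A
  ... | just p  = p ∷ psiFrom k (deleteGroup A p)
  ... | nothing = r ∷ psiFrom k A

  psi : (k : ℕ) → Vec (Fin n) k
  psi k = psiFrom k (tabulate (λ _ → true))

  indegMult : ℕ → ℕ
  indegMult i = length (filter (λ v → ∣ childGroup v ∣ ℕ.≟ i) (allFin n))

InTrees : {n : ℕ} {r : Fin n} → ℕ → RTree n r → Set
InTrees k T = length (phiGlo T) ≡ k

-- Π^{(r)}_{n,k}: set partitions of [n]∖{r} into k blocks, given as a list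
-- of blocks (nonempty, pairwise disjoint, not containing r, covering [n]∖{r});
-- two such lists represent the same partition iff they are permutations of
-- each other.
IsPartition : {n : ℕ} → Fin n → ℕ → List (Subset n) → Set
IsPartition {n} r k P =
  All Nonempty P ×
  AllPairs (λ B C → Empty (B ∩ C)) P ×
  All (λ B → r ∉ B) P ×
  (∀ u → u ≢ r → Any (λ B → u ∈ B) P) ×
  length P ≡ k

IsSeq : {n : ℕ} → Fin n → (k : ℕ) → Vec (Fin n) k → Set
IsSeq r k s = Unique (toList s) × (∀ i → suc (toℕ i) ≡ k → lookup s i ≡ r)

typeMult : {n : ℕ} → List (Subset n) → ℕ → ℕ
typeMult P i = length (filter (λ B → ∣ B ∣ ℕ.≟ i) P)

module Submission where

-- A stage of the peeling that defines ψ is the set A of surviving vertices.  A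
-- stays closed under the parent map, and each step removes exactly one vertex,
-- the parent of the deleted leaf-group, from the internal vertices (those with a
-- child in A); so ψ(T) lists the k internal vertices once each, ending at r (§5).
-- φ_glo(T) is a partition whose block sizes are the indegrees (§6).  Injectivity
-- (§7): if φ_glo and ψ agree, both peelings delete the same block from the same
-- parent at every stage.  Surjectivity (§8): the peeling is inverted block by
-- block; the leaf-groups of the current tree are the blocks avoiding the rest of
-- the sequence, and the one with the largest element hangs from the next entry.
-- §1–§4 provide facts on booleans, counting, maxima and the selection of the
-- largest leaf-group; the theorem (§9) just assembles §6–§8.

open import Defs
open import Data.Nat as ℕ using (ℕ; zero; suc; _≤_; _<_; _⊔_; _+_; _∸_; z≤n; s≤s)
import Data.Nat.Properties as ℕP
open import Data.Bool using (Bool; true; false; _∧_; _∨_; not; if_then_else_)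
import Data.Bool as 𝔹
import Data.Bool.Properties as 𝔹P
open import Data.Bool.ListAction using (any; all)
open import Data.Fin as F using (Fin; toℕ; _≟_)
import Data.Fin.Properties as FP
open import Data.Fin.Subset using (Subset; _∈_; _∉_; _∩_; ∣_∣; Nonempty; Empty)
import Data.Fin.Subset as Sub
import Data.Fin.Subset.Properties as SubP
open import Data.List using (List; []; _∷_; length; filter; map; foldr; allFin)
import Data.List.Properties as LP
open import Data.List.Membership.Propositional using (find) renaming (_∈_ to _∈L_)
import Data.List.Membership.Propositional.Properties as LMP
open import Data.List.Membership.Propositional.Properties.WithK using (unique∧set⇒bag)
open import Data.List.Relation.Unary.Any as Any using (Any; here; there)
open import Data.List.Relation.Unary.All as All using (All; []; _∷_)
import Data.List.Relation.Unary.All.Properties as AllP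
open import Data.List.Relation.Unary.AllPairs as AP using (AllPairs; []; _∷_)
import Data.List.Relation.Unary.AllPairs.Properties as APP
open import Data.List.Relation.Unary.Unique.Propositional using (Unique)
import Data.List.Relation.Unary.Unique.Propositional.Properties as UP
open import Data.List.Relation.Binary.Permutation.Propositional using (_↭_; ↭-sym)
import Data.List.Relation.Binary.Permutation.Propositional.Properties as PermP
open import Data.List.Relation.Binary.BagAndSetEquality using (∼bag⇒↭)
open import Data.Maybe using (Maybe; just; nothing)
open import Data.Vec using (Vec; []; _∷_; tabulate; lookup; toList)
import Data.Vec.Properties as VP
import Data.Vec.Membership.Propositional.Properties as VMP
open import Data.Product using (Σ; _×_; _,_; proj₁; proj₂)
open import Data.Sum using (_⊎_; inj₁; inj₂)
open import Data.Empty using (⊥; ⊥-elim)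
open import Function.Bundles using (mk⇔)
open import Relation.Binary.PropositionalEquality
open import Relation.Nullary using (¬_; Dec; yes; no; does)
open import Relation.Nullary.Decidable using (⌊_⌋; ¬?)

∧-true : ∀ {a b} → a ∧ b ≡ true → a ≡ true × b ≡ true
∧-true {true} {true} _ = refl , refl

∧-intro : ∀ {a b} → a ≡ true → b ≡ true → a ∧ b ≡ true
∧-intro refl refl = refl

not-true : ∀ {a} → not a ≡ true → a ≡ false
not-true {false} _ = refl

not-false : ∀ {a} → a ≡ false → not a ≡ true
not-false refl = refl

true≢false : ∀ {a} → a ≡ true → a ≡ false → ⊥
true≢false refl ()

implication-true : ∀ c {ℓ} → ℓ ≡ true → (not c ∨ ℓ) ≡ true
implication-true c refl = 𝔹P.∨-zeroʳ (not c)

implication-false : ∀ {c ℓ} → (not c ∨ ℓ) ≡ false → c ≡ true × ℓ ≡ false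
implication-false {true} {false} _ = refl , refl

∧-not-false : ∀ {a h} → a ≡ true → (a ∧ not h) ≡ false → h ≡ true
∧-not-false {true} {true} _ _ = refl

⌊⌋-true⇒ : ∀ {p} {P : Set p} (d : Dec P) → ⌊ d ⌋ ≡ true → P
⌊⌋-true⇒ (yes p) _ = p

⌊⌋-false⇒ : ∀ {p} {P : Set p} (d : Dec P) → ⌊ d ⌋ ≡ false → ¬ P
⌊⌋-false⇒ (no ¬p) _ = ¬p

⌊⌋-true⇐ : ∀ {p} {P : Set p} (d : Dec P) → P → ⌊ d ⌋ ≡ true
⌊⌋-true⇐ (yes _)  _ = refl
⌊⌋-true⇐ (no ¬p)  p = ⊥-elim (¬p p)

⌊⌋-false⇐ : ∀ {p} {P : Set p} (d : Dec P) → ¬ P → ⌊ d ⌋ ≡ false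
⌊⌋-false⇐ (yes p) ¬p = ⊥-elim (¬p p)
⌊⌋-false⇐ (no _)  _  = refl

bool-split : (b : Bool) → b ≡ true ⊎ b ≡ false
bool-split true  = inj₁ refl
bool-split false = inj₂ refl

bool-iff : ∀ {a b : Bool} → (a ≡ true → b ≡ true) → (b ≡ true → a ≡ true) → a ≡ b
bool-iff {false} {false} _ _ = refl
bool-iff {false} {true}  _ g = g refl
bool-iff {true}  {false} f _ = sym (f refl)
bool-iff {true}  {true}  _ _ = refl

module _ {A : Set} where

  any⇒ : (f : A → Bool) (xs : List A) → any f xs ≡ true → Σ A (λ x → x ∈L xs × f x ≡ true)
  any⇒ f (x ∷ xs) e with bool-split (f x)
  ... | inj₁ fx = x , here refl , fx
  ... | inj₂ fx rewrite fx with any⇒ f xs e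
  ...   | y , y∈xs , fy = y , there y∈xs , fy

  any⇐ : (f : A → Bool) {xs : List A} {x : A} → x ∈L xs → f x ≡ true → any f xs ≡ true
  any⇐ f {y ∷ xs} (here refl) e rewrite e = refl
  any⇐ f {y ∷ xs} (there x∈xs) e rewrite any⇐ f x∈xs e = 𝔹P.∨-zeroʳ (f y)

  any-false : (f : A → Bool) {xs : List A} → any f xs ≡ false → ∀ {x} → x ∈L xs → f x ≡ false
  any-false f e {x} x∈xs with bool-split (f x)
  ... | inj₁ t = ⊥-elim (true≢false (any⇐ f x∈xs t) e)
  ... | inj₂ t = t

  all⇒ : (f : A → Bool) {xs : List A} → all f xs ≡ true → ∀ {x} → x ∈L xs → f x ≡ true
  all⇒ f {y ∷ xs} e (here refl)  = proj₁ (∧-true e)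
  all⇒ f {y ∷ xs} e (there x∈xs) = all⇒ f (proj₂ (∧-true {f y} e)) x∈xs

  all⇐ : (f : A → Bool) (xs : List A) → (∀ x → x ∈L xs → f x ≡ true) → all f xs ≡ true
  all⇐ f []       _ = refl
  all⇐ f (x ∷ xs) h rewrite h x (here refl) = all⇐ f xs (λ y y∈xs → h y (there y∈xs))

  all-false⇒ : (f : A → Bool) (xs : List A) → all f xs ≡ false → Σ A (λ x → f x ≡ false)
  all-false⇒ f (x ∷ xs) e with bool-split (f x)
  ... | inj₂ fx = x , fx
  ... | inj₁ fx rewrite fx = all-false⇒ f xs e

  any-cong : (f g : A → Bool) (xs : List A) → (∀ x → f x ≡ g x) → any f xs ≡ any g xs
  any-cong f g []       _ = refl
  any-cong f g (x ∷ xs) h rewrite h x | any-cong f g xs h = refl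

module _ {n : ℕ} where

  anyFin⇒ : (f : Fin n → Bool) → any f (allFin n) ≡ true → Σ (Fin n) (λ x → f x ≡ true)
  anyFin⇒ f e with any⇒ f (allFin n) e
  ... | x , _ , fx = x , fx

  anyFin⇐ : (f : Fin n → Bool) (x : Fin n) → f x ≡ true → any f (allFin n) ≡ true
  anyFin⇐ f x = any⇐ f (LMP.∈-allFin x)

  anyFin-false : (f : Fin n → Bool) → any f (allFin n) ≡ false → ∀ x → f x ≡ false
  anyFin-false f e x = any-false f e (LMP.∈-allFin x)

  allFin⇒ : (f : Fin n → Bool) → all f (allFin n) ≡ true → ∀ x → f x ≡ true
  allFin⇒ f e x = all⇒ f e (LMP.∈-allFin x)

  allFin⇐ : (f : Fin n → Bool) → (∀ x → f x ≡ true) → all f (allFin n) ≡ true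
  allFin⇐ f h = all⇐ f (allFin n) (λ x _ → h x)

∈⇒lookup : ∀ {n} {B : Subset n} {x} → x ∈ B → lookup B x ≡ true
∈⇒lookup = VP.[]=⇒lookup

lookup⇒∈ : ∀ {n} {B : Subset n} {x} → lookup B x ≡ true → x ∈ B
lookup⇒∈ = VP.lookup⇒[]= _ _

vec-ext : ∀ {n} {A : Set} (u v : Vec A n) → (∀ i → lookup u i ≡ lookup v i) → u ≡ v
vec-ext u v h = trans (sym (VP.tabulate∘lookup u)) (trans (VP.tabulate-cong h) (VP.tabulate∘lookup v))

meet⇒⊥ : ∀ {n} (B C : Subset n) x → lookup B x ≡ true → lookup C x ≡ true → ¬ Empty (B ∩ C)
meet⇒⊥ B C x bx cx emp = emp (x , lookup⇒∈ (trans (VP.lookup-zipWith _∧_ x B C) (∧-intro bx cx)))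

disjoint⇒distinct : ∀ {n} (Q : List (Subset n)) → All Nonempty Q → AllPairs (λ B C → Empty (B ∩ C)) Q → Unique Q
disjoint⇒distinct []      _                 _          = []
disjoint⇒distinct (B ∷ Q) ((x , x∈B) ∷ ne) (B#Q ∷ Q#) =
  All.map (λ {C} B#C B≡C → meet⇒⊥ B C x (∈⇒lookup x∈B) (subst (λ D → lookup D x ≡ true) B≡C (∈⇒lookup x∈B)) B#C) B#Q
  ∷ disjoint⇒distinct Q ne Q#

count : ∀ {A : Set} → (A → Bool) → List A → ℕ
count f []       = 0
count f (x ∷ xs) = if f x then suc (count f xs) else count f xs

module _ {A : Set} where

  length-filter-true : (f : A → Bool) (xs : List A) →
    length (filter (λ x → f x 𝔹.≟ true) xs) ≡ count f xs
  length-filter-true f []       = refl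
  length-filter-true f (x ∷ xs) with f x
  ... | true  = cong suc (length-filter-true f xs)
  ... | false = length-filter-true f xs

  length-filter-map : ∀ {B : Set} {p} {P : B → Set p} (P? : ∀ b → Dec (P b)) (g : A → B) (xs : List A) →
    length (filter P? (map g xs)) ≡ length (filter (λ x → P? (g x)) xs)
  length-filter-map P? g []       = refl
  length-filter-map P? g (x ∷ xs) with does (P? (g x))
  ... | true  = cong suc (length-filter-map P? g xs)
  ... | false = length-filter-map P? g xs

  length-filter-filter : ∀ {p q} {P : A → Set p} {Q : A → Set q}
    (P? : ∀ x → Dec (P x)) (Q? : ∀ x → Dec (Q x)) (xs : List A) → (∀ x → P x → Q x) →
    length (filter P? (filter Q? xs)) ≡ length (filter P? xs)
  length-filter-filter P? Q? []       _ = refl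
  length-filter-filter P? Q? (x ∷ xs) P⇒Q with Q? x
  ... | yes _ = keep
    where
    keep : length (filter P? (x ∷ filter Q? xs)) ≡ length (filter P? (x ∷ xs))
    keep with does (P? x)
    ... | true  = cong suc (length-filter-filter P? Q? xs P⇒Q)
    ... | false = length-filter-filter P? Q? xs P⇒Q
  ... | no ¬q with P? x
  ...   | yes p = ⊥-elim (¬q (P⇒Q x p))
  ...   | no  _ = length-filter-filter P? Q? xs P⇒Q

  count-cong : (f g : A → Bool) (xs : List A) → (∀ x → x ∈L xs → f x ≡ g x) → count f xs ≡ count g xs
  count-cong f g []       _ = refl
  count-cong f g (x ∷ xs) h rewrite h x (here refl) | count-cong f g xs (λ y m → h y (there m)) = refl

  count-zero : (f : A → Bool) (xs : List A) → count f xs ≡ 0 → ∀ {x} → x ∈L xs → f x ≡ false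
  count-zero f (y ∷ xs) e (here refl) with f y
  ... | false = refl
  count-zero f (y ∷ xs) e (there m) with f y
  ... | false = count-zero f xs e m

  count-all : (f : A → Bool) (xs : List A) → (∀ x → x ∈L xs → f x ≡ true) → count f xs ≡ length xs
  count-all f []       _ = refl
  count-all f (x ∷ xs) h rewrite h x (here refl) = cong suc (count-all f xs (λ y m → h y (there m)))

  count-suc : (f : A → Bool) (xs : List A) {m : ℕ} → count f xs ≡ suc m → Σ A (λ x → f x ≡ true)
  count-suc f (x ∷ xs) e with bool-split (f x)
  ... | inj₁ fx = x , fx
  ... | inj₂ fx rewrite fx = count-suc f xs e

  count-step : (f g : A → Bool) (p : A) (xs : List A) → Unique xs → p ∈L xs →
    f p ≡ true → g p ≡ false → (∀ v → v ∈L xs → v ≢ p → f v ≡ g v) → count f xs ≡ suc (count g xs)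
  count-step f g p (y ∷ ys) (y∉ys ∷ _) (here refl) fp gp h rewrite fp | gp =
    cong suc (count-cong f g ys (λ v m → h v (there m) (λ e → All.lookup y∉ys m (sym e))))
  count-step f g p (y ∷ ys) (y∉ys ∷ uys) (there m) fp gp h rewrite h y (here refl) (All.lookup y∉ys m) with g y
  ... | true  = cong suc (count-step f g p ys uys m fp gp (λ v mv → h v (there mv)))
  ... | false = count-step f g p ys uys m fp gp (λ v mv → h v (there mv))

allPairs-lookup : ∀ {A : Set} {ℓ} {R : A → A → Set ℓ} {xs : List A} → AllPairs R xs →
  ∀ {b c} → b ∈L xs → c ∈L xs → b ≡ c ⊎ R b c ⊎ R c b
allPairs-lookup (_ ∷ _)    (here refl) (here refl) = inj₁ refl
allPairs-lookup (x#xs ∷ _) (here refl) (there c∈)  = inj₂ (inj₁ (All.lookup x#xs c∈))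
allPairs-lookup (x#xs ∷ _) (there b∈)  (here refl) = inj₂ (inj₂ (All.lookup x#xs b∈))
allPairs-lookup (_ ∷ xs#)  (there b∈)  (there c∈)  = allPairs-lookup xs# b∈ c∈

module _ {n : ℕ} where

  pigeonhole : (f : Subset n → Bool) (R : List (Subset n)) (X : List (Fin n)) →
    AllPairs (λ B C → Empty (B ∩ C)) R →
    (∀ B → B ∈L R → f B ≡ true → Σ (Fin n) (λ x → x ∈L X × lookup B x ≡ true)) → count f R ≤ length X
  pigeonhole f []      X _           _ = z≤n
  pigeonhole f (B ∷ R) X (B#R ∷ R#) h with bool-split (f B)
  ... | inj₂ fB rewrite fB = pigeonhole f R X R# (λ C m fC → h C (there m) fC)
  ... | inj₁ fB rewrite fB with h B (here refl) fB
  ...   | x , x∈X , Bx =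
    ℕP.≤-trans (s≤s (pigeonhole f R X′ R# h′)) (LP.filter-notAll (λ y → ¬? (y ≟ x)) X (Any.map (λ e ne → ne (sym e)) x∈X))
    where
    X′ = filter (λ y → ¬? (y ≟ x)) X
    h′ : ∀ C → C ∈L R → f C ≡ true → Σ (Fin n) (λ y → y ∈L X′ × lookup C y ≡ true)
    h′ C m fC with h C (there m) fC
    ... | y , y∈X , Cy = y , LMP.∈-filter⁺ (λ y → ¬? (y ≟ x)) y∈X (λ { refl → meet⇒⊥ B C y Bx Cy (All.lookup B#R m) }) , Cy

  meets-or-avoids : (f : Subset n → Bool) (R : List (Subset n)) (X : List (Fin n)) →
    (∀ B → B ∈L R → f B ≡ true → Σ (Fin n) (λ x → x ∈L X × lookup B x ≡ true)) ⊎
    Σ (Subset n) (λ B → B ∈L R × f B ≡ true × (∀ x → x ∈L X → lookup B x ≡ false))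
  meets-or-avoids f []      X = inj₁ (λ B ())
  meets-or-avoids f (B ∷ R) X with meets-or-avoids f R X
  ... | inj₂ (C , m , fC , h) = inj₂ (C , there m , fC , h)
  ... | inj₁ h with bool-split (f B)
  ...   | inj₂ fB = inj₁ λ { C (here refl) fC → ⊥-elim (true≢false fC fB) ; C (there m) fC → h C m fC }
  ...   | inj₁ fB with bool-split (any (lookup B) X)
  ...     | inj₂ nb = inj₂ (B , here refl , fB , λ x m → any-false (lookup B) nb m)
  ...     | inj₁ ab with any⇒ (lookup B) X ab
  ...       | x , m , Bx = inj₁ λ { C (here refl) fC → x , m , Bx ; C (there m′) fC → h C m′ fC }

-- 1 + the largest index in xs satisfying c (0 if there is none);
-- maxChild T A v is maxIndex (childIn T A v) (allFin n)
maxIndex : ∀ {n} → (Fin n → Bool) → List (Fin n) → ℕ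
maxIndex c = foldr (λ u m → if c u then suc (toℕ u) ⊔ m else m) 0

module _ {n : ℕ} (c : Fin n → Bool) where

  maxIndex-ub : (xs : List (Fin n)) (u : Fin n) → u ∈L xs → c u ≡ true → suc (toℕ u) ≤ maxIndex c xs
  maxIndex-ub (y ∷ xs) u (here refl) e rewrite e = ℕP.m≤m⊔n (suc (toℕ y)) (maxIndex c xs)
  maxIndex-ub (y ∷ xs) u (there m)   e with c y
  ... | true  = ℕP.≤-trans (maxIndex-ub xs u m e) (ℕP.m≤n⊔m (suc (toℕ y)) (maxIndex c xs))
  ... | false = maxIndex-ub xs u m e

  maxIndex-attained : (xs : List (Fin n)) →
    maxIndex c xs ≡ 0 ⊎ Σ (Fin n) (λ y → c y ≡ true × maxIndex c xs ≡ suc (toℕ y))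
  maxIndex-attained []       = inj₁ refl
  maxIndex-attained (y ∷ xs) with bool-split (c y)
  ... | inj₂ e rewrite e = maxIndex-attained xs
  ... | inj₁ e rewrite e with maxIndex-attained xs
  ...   | inj₁ z rewrite z = inj₂ (y , e , ℕP.⊔-identityʳ (suc (toℕ y)))
  ...   | inj₂ (w , cw , eq) rewrite eq with ℕP.≤-total (toℕ y) (toℕ w)
  ...     | inj₁ y≤w = inj₂ (w , cw , ℕP.m≤n⇒m⊔n≡n (s≤s y≤w))
  ...     | inj₂ w≤y = inj₂ (y , e , ℕP.m≥n⇒m⊔n≡m (s≤s w≤y))

maxIndex-cong : ∀ {n} (c d : Fin n → Bool) (xs : List (Fin n)) → (∀ u → c u ≡ d u) → maxIndex c xs ≡ maxIndex d xs
maxIndex-cong c d []       _ = refl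
maxIndex-cong c d (x ∷ xs) h rewrite h x | maxIndex-cong c d xs h = refl

largestWith : ∀ {n} → (Fin n → Bool) → Maybe (Fin n)
largestWith {zero}  f = nothing
largestWith {suc n} f with largestWith (λ i → f (F.suc i))
... | just x  = just (F.suc x)
... | nothing = if f F.zero then just F.zero else nothing

largestWith-nothing : ∀ {n} (f : Fin n → Bool) → largestWith f ≡ nothing → ∀ y → f y ≡ false
largestWith-nothing {suc n} f e y with largestWith (λ i → f (F.suc i)) in eq
largestWith-nothing {suc n} f () y | just _
... | nothing with bool-split (f F.zero)
...   | inj₁ f0 rewrite f0 with e
...     | ()
largestWith-nothing {suc n} f e F.zero    | nothing | inj₂ f0 = f0
largestWith-nothing {suc n} f e (F.suc y) | nothing | inj₂ _  = largestWith-nothing (λ i → f (F.suc i)) eq y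

largestWith-just : ∀ {n} (f : Fin n → Bool) x → largestWith f ≡ just x →
  f x ≡ true × (∀ y → f y ≡ true → toℕ y ≤ toℕ x)
largestWith-just {suc n} f x e with largestWith (λ i → f (F.suc i)) in eq
... | just x′ with e
...   | refl with largestWith-just (λ i → f (F.suc i)) x′ eq
...     | fx , max = fx , λ { F.zero _ → z≤n ; (F.suc y) fy → s≤s (max y fy) }
largestWith-just {suc n} f x e | nothing with bool-split (f F.zero)
... | inj₂ f0 rewrite f0 with e
...   | ()
largestWith-just {suc n} f x e | nothing | inj₁ f0 rewrite f0 with e
... | refl = f0 , λ { F.zero _ → z≤n ; (F.suc y) fy → ⊥-elim (true≢false fy (largestWith-nothing (λ i → f (F.suc i)) eq y)) }

module _ {A : Set} (f : A → A) where

  iter-fix : ∀ m x → f x ≡ x → iter f m x ≡ x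
  iter-fix zero    x _ = refl
  iter-fix (suc m) x e rewrite e = iter-fix m x e

  iter-suc : ∀ m x → iter f (suc m) x ≡ f (iter f m x)
  iter-suc zero    x = refl
  iter-suc (suc m) x = iter-suc m (f x)

  iter-+ : ∀ a b x → iter f (a + b) x ≡ iter f b (iter f a x)
  iter-+ zero    b x = refl
  iter-+ (suc a) b x = iter-+ a b (f x)

-- §4 Children inside a surviving vertex set; the largest leaf-group

-- The comparison step folded by largestLGParent is local to Defs; unification
-- against the unfolded definition recovers it (the implicit g).
selectionStepOf : ∀ {n} {r : Fin n} (T : RTree n r) (A : Subset n) {g : Fin n → Maybe (Fin n) → Maybe (Fin n)} →
  largestLGParent T A ≡ foldr g nothing (allFin n) → Fin n → Maybe (Fin n) → Maybe (Fin n)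
selectionStepOf T A {g} _ = g

module Tree {n : ℕ} {r : Fin n} (T : RTree n r) where

  fixed⇒root : ∀ v → par T v ≡ v → v ≡ r
  fixed⇒root v e = trans (sym (iter-fix (par T) n v e)) (reach T v)

  isChild⇒ : ∀ u v → isChildB T u v ≡ true → u ≢ r × par T u ≡ v
  isChild⇒ u v e with ∧-true {not ⌊ u ≟ r ⌋} e
  ... | u≢r , pu≡v = ⌊⌋-false⇒ (u ≟ r) (not-true u≢r) , ⌊⌋-true⇒ (par T u ≟ v) pu≡v

  isChild⇐ : ∀ u v → u ≢ r → par T u ≡ v → isChildB T u v ≡ true
  isChild⇐ u v u≢r pu≡v rewrite ⌊⌋-false⇐ (u ≟ r) u≢r | ⌊⌋-true⇐ (par T u ≟ v) pu≡v = refl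

  childIn⇒ : ∀ A v u → childIn T A v u ≡ true →
    lookup A u ≡ true × lookup A v ≡ true × u ≢ r × par T u ≡ v
  childIn⇒ A v u e with ∧-true {lookup A u} e
  ... | Au , rest with ∧-true {lookup A v} rest
  ...   | Av , ch = Au , Av , isChild⇒ u v ch

  childIn⇐ : ∀ A v u → lookup A u ≡ true → lookup A v ≡ true → u ≢ r → par T u ≡ v → childIn T A v u ≡ true
  childIn⇐ A v u Au Av u≢r pu≡v rewrite Au | Av = isChild⇐ u v u≢r pu≡v

  hasChild⇒ : ∀ A v → hasChildIn T A v ≡ true → Σ (Fin n) (λ u → childIn T A v u ≡ true)
  hasChild⇒ A v = anyFin⇒ (childIn T A v)

  hasChild⇐ : ∀ A v u → childIn T A v u ≡ true → hasChildIn T A v ≡ true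
  hasChild⇐ A v = anyFin⇐ (childIn T A v)

  leafGroup⇒ : ∀ A v → leafGroupAt T A v ≡ true →
    hasChildIn T A v ≡ true × (∀ u → childIn T A v u ≡ true → hasChildIn T A u ≡ false)
  leafGroup⇒ A v e with ∧-true {hasChildIn T A v} e
  ... | hv , allLeaves = hv , λ u cu → leaf u cu (allFin⇒ _ allLeaves u)
    where
    leaf : ∀ u → childIn T A v u ≡ true → (not (childIn T A v u) ∨ leafIn T A u) ≡ true → hasChildIn T A u ≡ false
    leaf u cu e′ rewrite cu = not-true (proj₂ (∧-true {lookup A u} e′))

  leafGroup⇐ : ∀ A v → hasChildIn T A v ≡ true →
    (∀ u → childIn T A v u ≡ true → hasChildIn T A u ≡ false) → leafGroupAt T A v ≡ true
  leafGroup⇐ A v hv leaves rewrite hv = allFin⇐ _ leaf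
    where
    leaf : ∀ u → (not (childIn T A v u) ∨ leafIn T A u) ≡ true
    leaf u with bool-split (childIn T A v u)
    ... | inj₂ e rewrite e = refl
    ... | inj₁ e = implication-true (childIn T A v u) (∧-intro (proj₁ (childIn⇒ A v u e)) (not-false (leaves u e)))

  nonLeafGroup⇒ : ∀ A w → hasChildIn T A w ≡ true → leafGroupAt T A w ≡ false →
    Σ (Fin n) (λ u → childIn T A w u ≡ true × hasChildIn T A u ≡ true)
  nonLeafGroup⇒ A w hw e rewrite hw with all-false⇒ _ (allFin n) e
  ... | u , fu with implication-false fu
  ...   | cu , notLeaf = u , cu , ∧-not-false (proj₁ (childIn⇒ A w u cu)) notLeaf

  maxChild-ub : ∀ A v u → childIn T A v u ≡ true → suc (toℕ u) ≤ maxChild T A v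
  maxChild-ub A v u = maxIndex-ub (childIn T A v) (allFin n) u (LMP.∈-allFin u)

  maxChild-attained : ∀ A v → hasChildIn T A v ≡ true →
    Σ (Fin n) (λ y → childIn T A v y ≡ true × maxChild T A v ≡ suc (toℕ y))
  maxChild-attained A v hv with maxIndex-attained (childIn T A v) (allFin n)
  ... | inj₂ w = w
  ... | inj₁ zero≡ with hasChild⇒ A v hv
  ...   | u , cu with maxChild-ub A v u cu
  ...     | le rewrite zero≡ with le
  ...       | ()

  maxChild-injective : ∀ A v w → hasChildIn T A v ≡ true → hasChildIn T A w ≡ true →
    maxChild T A v ≡ maxChild T A w → v ≡ w
  maxChild-injective A v w hv hw e with maxChild-attained A v hv | maxChild-attained A w hw
  ... | y , cy , my | y′ , cy′ , my′ with FP.toℕ-injective (ℕP.suc-injective (trans (sym my) (trans e my′)))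
  ...   | refl = trans (sym (proj₂ (proj₂ (proj₂ (childIn⇒ A v y cy))))) (proj₂ (proj₂ (proj₂ (childIn⇒ A w y cy′))))

  LargestIn : Subset n → List (Fin n) → Fin n → Set
  LargestIn A xs p = leafGroupAt T A p ≡ true ×
    (∀ v → v ∈L xs → leafGroupAt T A v ≡ true → maxChild T A v ≤ maxChild T A p)

  module Selection (A : Subset n) where

    select = selectionStepOf T A refl

    selection : ∀ xs →
      (∀ p → foldr select nothing xs ≡ just p → LargestIn A xs p) ×
      (foldr select nothing xs ≡ nothing → ∀ v → v ∈L xs → leafGroupAt T A v ≡ false)
    selection []       = (λ _ ()) , (λ _ _ ())
    selection (x ∷ xs) with selection xs | bool-split (leafGroupAt T A x)
    ... | ih-just , ih-nothing | inj₂ lx = just-case , nothing-case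
      where
      skip : select x (foldr select nothing xs) ≡ foldr select nothing xs
      skip rewrite lx = refl
      just-case : ∀ p → select x (foldr select nothing xs) ≡ just p → LargestIn A (x ∷ xs) p
      just-case p e with ih-just p (trans (sym skip) e)
      ... | lp , max = lp , λ { v (here refl) lv → ⊥-elim (true≢false lv lx) ; v (there m) lv → max v m lv }
      nothing-case : select x (foldr select nothing xs) ≡ nothing → ∀ v → v ∈L x ∷ xs → leafGroupAt T A v ≡ false
      nothing-case e v (here refl) = lx
      nothing-case e v (there m)   = ih-nothing (trans (sym skip) e) v m
    ... | ih-just , ih-nothing | inj₁ lx with foldr select nothing xs in eq
    ...   | nothing = just-case , nothing-case
      where
      first : select x nothing ≡ just x
      first rewrite lx = refl
      just-case : ∀ p → select x nothing ≡ just p → LargestIn A (x ∷ xs) p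
      just-case p e with trans (sym first) e
      ... | refl = lx , λ { v (here refl) lv → ℕP.≤-refl ; v (there m) lv → ⊥-elim (true≢false lv (ih-nothing refl v m)) }
      nothing-case : select x nothing ≡ nothing → ∀ v → v ∈L x ∷ xs → leafGroupAt T A v ≡ false
      nothing-case e with trans (sym first) e
      ... | ()
    ...   | just w = just-case , nothing-case
      where
      compare : select x (just w) ≡ (if ⌊ maxChild T A w ℕ.<? maxChild T A x ⌋ then just x else just w)
      compare rewrite lx = refl
      lw = proj₁ (ih-just w refl)
      max-w = proj₂ (ih-just w refl)
      just-case : ∀ p → select x (just w) ≡ just p → LargestIn A (x ∷ xs) p
      just-case p e with maxChild T A w ℕ.<? maxChild T A x | trans (sym compare) e
      ... | yes w<x | refl = lx , λ { v (here refl) lv → ℕP.≤-refl ; v (there m) lv → ℕP.≤-trans (max-w v m lv) (ℕP.<⇒≤ w<x) }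
      ... | no  w≮x | refl = lw , λ { v (here refl) lv → ℕP.≮⇒≥ w≮x ; v (there m) lv → max-w v m lv }
      nothing-case : select x (just w) ≡ nothing → ∀ v → v ∈L x ∷ xs → leafGroupAt T A v ≡ false
      nothing-case e with maxChild T A w ℕ.<? maxChild T A x | trans (sym compare) e
      ... | yes _ | ()
      ... | no  _ | ()

  largest-just : ∀ A p → largestLGParent T A ≡ just p →
    leafGroupAt T A p ≡ true × (∀ v → leafGroupAt T A v ≡ true → maxChild T A v ≤ maxChild T A p)
  largest-just A p e with proj₁ (Selection.selection A (allFin n)) p e
  ... | lp , max = lp , λ v → max v (LMP.∈-allFin v)

  largest-nothing : ∀ A → largestLGParent T A ≡ nothing → ∀ v → leafGroupAt T A v ≡ false
  largest-nothing A e v = proj₂ (Selection.selection A (allFin n)) e v (LMP.∈-allFin v)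

  psi-step : ∀ k A p → largestLGParent T A ≡ just p → psiFrom T (suc k) A ≡ p ∷ psiFrom T k (deleteGroup T A p)
  psi-step k A p e rewrite e = refl

  deleteGroup-lookup : ∀ A p u → lookup (deleteGroup T A p) u ≡ (lookup A u ∧ not (childIn T A p u))
  deleteGroup-lookup A p u = VP.lookup∘tabulate _ u

-- §5 Peeling: ψ lists every internal vertex once and ends at the root

module Peeling {n : ℕ} {r : Fin n} (T : RTree n r) where
  open Tree T

  ParentClosed : Subset n → Set
  ParentClosed A = ∀ u → lookup A u ≡ true → lookup A (par T u) ≡ true

  #internal : Subset n → ℕ
  #internal A = count (hasChildIn T A) (allFin n)

  downStep : ∀ A w → hasChildIn T A w ≡ true →
    Σ (Fin n) (λ x → leafGroupAt T A x ≡ true) ⊎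
    Σ (Fin n) (λ u → hasChildIn T A u ≡ true × par T u ≡ w × u ≢ r)
  downStep A w hw with bool-split (leafGroupAt T A w)
  ... | inj₁ lw = inj₁ (w , lw)
  ... | inj₂ lw with nonLeafGroup⇒ A w hw lw
  ...   | u , cu , hu with childIn⇒ A w u cu
  ...     | _ , _ , u≢r , pu≡w = inj₂ (u , hu , pu≡w , u≢r)

  descent : ∀ A v → hasChildIn T A v ≡ true → ∀ t →
    Σ (Fin n) (λ x → leafGroupAt T A x ≡ true) ⊎
    Σ (Fin n) (λ w → hasChildIn T A w ≡ true × iter (par T) t w ≢ r)
  descent A v hv zero with downStep A v hv
  ... | inj₁ leaf = inj₁ leaf
  ... | inj₂ (u , hu , _ , u≢r) = inj₂ (u , hu , u≢r)
  descent A v hv (suc t) with descent A v hv t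
  ... | inj₁ leaf = inj₁ leaf
  ... | inj₂ (w , hw , deep) with downStep A w hw
  ...   | inj₁ leaf = inj₁ leaf
  ...   | inj₂ (u , hu , pu≡w , _) = inj₂ (u , hu , λ e → deep (subst (λ z → iter (par T) t z ≡ r) pu≡w e))

  -- a tree with an internal vertex has a leaf-group (descent cannot exceed n steps)
  leafGroup-exists : ∀ A v → hasChildIn T A v ≡ true → Σ (Fin n) (λ x → leafGroupAt T A x ≡ true)
  leafGroup-exists A v hv with descent A v hv n
  ... | inj₁ leaf = leaf
  ... | inj₂ (w , _ , deep) = ⊥-elim (deep (reach T w))

  largest-exists : ∀ A v → hasChildIn T A v ≡ true → Σ (Fin n) (λ p → largestLGParent T A ≡ just p)
  largest-exists A v hv with largestLGParent T A in eq
  ... | just p  = p , refl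
  ... | nothing with leafGroup-exists A v hv
  ...   | x , lx = ⊥-elim (true≢false lx (largest-nothing A eq x))

  module Step (A : Subset n) (p : Fin n) (lg : leafGroupAt T A p ≡ true) where

    A′ : Subset n
    A′ = deleteGroup T A p

    survivor⇒ : ∀ u → lookup A′ u ≡ true → lookup A u ≡ true × childIn T A p u ≡ false
    survivor⇒ u e with ∧-true {lookup A u} (trans (sym (deleteGroup-lookup A p u)) e)
    ... | Au , notDeleted = Au , not-true notDeleted

    survivor⇐ : ∀ u → lookup A u ≡ true → childIn T A p u ≡ false → lookup A′ u ≡ true
    survivor⇐ u Au c = trans (deleteGroup-lookup A p u) (∧-intro Au (not-false c))

    deleted-leaves : ∀ u → childIn T A p u ≡ true → hasChildIn T A u ≡ false
    deleted-leaves = proj₂ (leafGroup⇒ A p lg)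

    p∈A : lookup A p ≡ true
    p∈A = proj₁ (proj₂ (childIn⇒ A p _ (proj₂ (hasChild⇒ A p (proj₁ (leafGroup⇒ A p lg))))))

    -- a deleted vertex is a leaf, so the parent of a survivor survives
    stays-closed : ParentClosed A → ParentClosed A′
    stays-closed closedA u e with u ≟ r
    ... | yes refl = subst (λ z → lookup A′ z ≡ true) (sym (parRoot T)) e
    ... | no u≢r with survivor⇒ u e | bool-split (childIn T A p (par T u))
    ...   | Au , _ | inj₂ c = survivor⇐ (par T u) (closedA u Au) c
    ...   | Au , _ | inj₁ c =
      ⊥-elim (true≢false (hasChild⇐ A (par T u) u (childIn⇐ A (par T u) u Au (closedA u Au) u≢r refl)) (deleted-leaves (par T u) c))

    p-leaves : hasChildIn T A′ p ≡ false
    p-leaves with bool-split (hasChildIn T A′ p)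
    ... | inj₂ e = e
    ... | inj₁ e with hasChild⇒ A′ p e
    ...   | u , cu with childIn⇒ A′ p u cu
    ...     | u∈A′ , _ , u≢r , pu≡p with survivor⇒ u u∈A′
    ...       | Au , notDeleted = ⊥-elim (true≢false (childIn⇐ A p u Au p∈A u≢r pu≡p) notDeleted)

    others-unchanged : ∀ v → v ≢ p → hasChildIn T A v ≡ hasChildIn T A′ v
    others-unchanged v v≢p = bool-iff toA′ toA
      where
      toA : hasChildIn T A′ v ≡ true → hasChildIn T A v ≡ true
      toA h with hasChild⇒ A′ v h
      ... | u , cu with childIn⇒ A′ v u cu
      ...   | u∈A′ , v∈A′ , u≢r , pu≡v =
        hasChild⇐ A v u (childIn⇐ A v u (proj₁ (survivor⇒ u u∈A′)) (proj₁ (survivor⇒ v v∈A′)) u≢r pu≡v)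
      toA′ : hasChildIn T A v ≡ true → hasChildIn T A′ v ≡ true
      toA′ h with hasChild⇒ A v h
      ... | u , cu with childIn⇒ A v u cu
      ...   | Au , Av , u≢r , pu≡v = hasChild⇐ A′ v u (childIn⇐ A′ v u u∈A′ v∈A′ u≢r pu≡v)
        where
        u∈A′ : lookup A′ u ≡ true
        u∈A′ with bool-split (childIn T A p u)
        ... | inj₂ c = survivor⇐ u Au c
        ... | inj₁ c = ⊥-elim (v≢p (trans (sym pu≡v) (proj₂ (proj₂ (proj₂ (childIn⇒ A p u c))))))
        v∈A′ : lookup A′ v ≡ true
        v∈A′ with bool-split (childIn T A p v)
        ... | inj₂ c = survivor⇐ v Av c
        ... | inj₁ c = ⊥-elim (true≢false h (deleted-leaves v c))

    internal-shrinks : #internal A ≡ suc (#internal A′)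
    internal-shrinks = count-step (hasChildIn T A) (hasChildIn T A′) p (allFin n) (UP.allFin⁺ n) (LMP.∈-allFin p)
      (proj₁ (leafGroup⇒ A p lg)) p-leaves (λ v _ → others-unchanged v)

  record InternalListing (A : Subset n) {m : ℕ} (s : Vec (Fin n) m) : Set where
    field
      distinct        : Unique (toList s)
      ends-in-root    : ∀ i → suc (toℕ i) ≡ m → lookup s i ≡ r
      listed⇒internal : ∀ x → x ∈L toList s → hasChildIn T A x ≡ true
      internal⇒listed : ∀ x → hasChildIn T A x ≡ true → x ∈L toList s

  psi-spec : ∀ m A → ParentClosed A → #internal A ≡ m → InternalListing A (psiFrom T m A)
  psi-spec zero A _ noInternal = record
    { distinct = []
    ; ends-in-root = λ ()
    ; listed⇒internal = λ _ ()
    ; internal⇒listed = λ x hx → ⊥-elim (true≢false hx (count-zero _ (allFin n) noInternal (LMP.∈-allFin x)))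
    }
  psi-spec (suc m) A closedA #A with count-suc (hasChildIn T A) (allFin n) #A
  ... | v , hv with largest-exists A v hv
  ...   | p , eq rewrite psi-step m A p eq = record
    { distinct = All.tabulate (λ {x} mx e → true≢false (IH.listed⇒internal x mx) (subst (λ z → hasChildIn T A′ z ≡ false) e p-leaves))
               ∷ IH.distinct
    ; ends-in-root = last
    ; listed⇒internal = λ { x (here refl) → proj₁ (leafGroup⇒ A p lg)
                          ; x (there mx) → internal′⇒internal x (IH.listed⇒internal x mx) }
    ; internal⇒listed = listed
    }
    where
    lg = proj₁ (largest-just A p eq)
    open Step A p lg
    #A′ : #internal A′ ≡ m
    #A′ = ℕP.suc-injective (trans (sym internal-shrinks) #A)
    module IH = InternalListing (psi-spec m A′ (stays-closed closedA) #A′)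
    internal′⇒internal : ∀ x → hasChildIn T A′ x ≡ true → hasChildIn T A x ≡ true
    internal′⇒internal x h with x ≟ p
    ... | yes refl = ⊥-elim (true≢false h p-leaves)
    ... | no x≢p = trans (others-unchanged x x≢p) h
    listed : ∀ x → hasChildIn T A x ≡ true → x ∈L (p ∷ toList (psiFrom T m A′))
    listed x hx with x ≟ p
    ... | yes refl = here refl
    ... | no x≢p = there (IH.internal⇒listed x (trans (sym (others-unchanged x x≢p)) hx))
    -- a last parent p ≠ r would leave its own parent internal in A′
    last : ∀ i → suc (toℕ i) ≡ suc m → lookup (p ∷ psiFrom T m A′) i ≡ r
    last (F.suc i) e = IH.ends-in-root i (ℕP.suc-injective e)
    last F.zero e with p ≟ r
    ... | yes p≡r = p≡r
    ... | no p≢r with par T p ≟ p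
    ...   | yes fixed = ⊥-elim (p≢r (fixed⇒root p fixed))
    ...   | no moved = ⊥-elim (true≢false parentInternal′ (count-zero _ (allFin n) noneLeft (LMP.∈-allFin (par T p))))
      where
      parentInternal′ : hasChildIn T A′ (par T p) ≡ true
      parentInternal′ = trans (sym (others-unchanged (par T p) moved))
        (hasChild⇐ A (par T p) p (childIn⇐ A (par T p) p p∈A (closedA p p∈A) p≢r refl))
      noneLeft : #internal A′ ≡ 0
      noneLeft = trans #A′ (sym (ℕP.suc-injective e))

-- §6 φ_glo(T) is a partition with k blocks whose type is the indegree sequence

full : ∀ {n} → Subset n
full = tabulate (λ _ → true)

full-lookup : ∀ {n} (u : Fin n) → lookup full u ≡ true
full-lookup u = VP.lookup∘tabulate (λ _ → true) u

size-empty : ∀ {n} (B : Subset n) → (∀ i → lookup B i ≡ false) → ∣ B ∣ ≡ 0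
size-empty {n} B none = trans (cong ∣_∣ B≡∅) (SubP.∣⊥∣≡0 n)
  where
  B≡∅ : B ≡ Sub.⊥
  B≡∅ = vec-ext B Sub.⊥ (λ i → trans (none i) (sym (VP.lookup-replicate i false)))

module Blocks {n : ℕ} {r : Fin n} (T : RTree n r) where
  open Tree T
  open Peeling T

  nonempty⇒ : ∀ B → nonemptyB T B ≡ true → Nonempty B
  nonempty⇒ B e with anyFin⇒ (lookup B) e
  ... | x , Bx = x , lookup⇒∈ Bx

  size⇒nonempty : ∀ B i → 1 ≤ i → ∣ B ∣ ≡ i → nonemptyB T B ≡ true
  size⇒nonempty B i 1≤i e with bool-split (nonemptyB T B)
  ... | inj₁ t = t
  ... | inj₂ f with trans (sym e) (size-empty B (anyFin-false (lookup B) f))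
  ...   | refl with 1≤i
  ...     | ()

  childGroup-lookup : ∀ v u → lookup (childGroup T v) u ≡ isChildB T u v
  childGroup-lookup v u = VP.lookup∘tabulate (λ u → isChildB T u v) u

  nonempty-internal : ∀ v → nonemptyB T (childGroup T v) ≡ hasChildIn T full v
  nonempty-internal v = any-cong _ _ (allFin n) (λ u →
    trans (childGroup-lookup v u) (cong₂ (λ a b → a ∧ b ∧ isChildB T u v) (sym (full-lookup u)) (sym (full-lookup v))))

  length-phiGlo : length (phiGlo T) ≡ #internal full
  length-phiGlo = begin
    length (phiGlo T)
      ≡⟨ length-filter-map (λ B → nonemptyB T B 𝔹.≟ true) (childGroup T) (allFin n) ⟩
    length (filter (λ v → nonemptyB T (childGroup T v) 𝔹.≟ true) (allFin n))
      ≡⟨ length-filter-true (λ v → nonemptyB T (childGroup T v)) (allFin n) ⟩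
    count (λ v → nonemptyB T (childGroup T v)) (allFin n)
      ≡⟨ count-cong _ _ (allFin n) (λ v _ → nonempty-internal v) ⟩
    #internal full ∎
    where open ≡-Reasoning

  full-closed : ParentClosed full
  full-closed u _ = full-lookup (par T u)

  ∈phiGlo⇒ : ∀ B → B ∈L phiGlo T → Σ (Fin n) (λ v → B ≡ childGroup T v × nonemptyB T B ≡ true)
  ∈phiGlo⇒ B m with LMP.∈-filter⁻ (λ B → nonemptyB T B 𝔹.≟ true) {xs = map (childGroup T) (allFin n)} m
  ... | m′ , ne with LMP.∈-map⁻ (childGroup T) m′
  ...   | v , _ , B≡ = v , B≡ , ne

  ∈phiGlo⇐ : ∀ v → nonemptyB T (childGroup T v) ≡ true → childGroup T v ∈L phiGlo T
  ∈phiGlo⇐ v ne = LMP.∈-filter⁺ (λ B → nonemptyB T B 𝔹.≟ true) (LMP.∈-map⁺ (childGroup T) (LMP.∈-allFin v)) ne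

  -- a vertex belongs to the child-group of its parent and to no other
  childGroups-disjoint : ∀ v w → v ≢ w → Empty (childGroup T v ∩ childGroup T w)
  childGroups-disjoint v w v≢w (x , x∈) with ∧-true (trans (sym (VP.lookup-zipWith _∧_ x (childGroup T v) (childGroup T w))) (∈⇒lookup x∈))
  ... | xv , xw = v≢w (trans (sym (proj₂ (isChild⇒ x v (trans (sym (childGroup-lookup v x)) xv))))
                             (proj₂ (isChild⇒ x w (trans (sym (childGroup-lookup w x)) xw))))

  root∉childGroup : ∀ v → r ∉ childGroup T v
  root∉childGroup v r∈ = proj₁ (isChild⇒ r v (trans (sym (childGroup-lookup v r)) (∈⇒lookup r∈))) refl

  ∈parentGroup : ∀ u → u ≢ r → lookup (childGroup T (par T u)) u ≡ true
  ∈parentGroup u u≢r = trans (childGroup-lookup (par T u) u) (isChild⇐ u (par T u) u≢r refl)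

  phiGlo-covers : ∀ u → u ≢ r → Any (λ B → u ∈ B) (phiGlo T)
  phiGlo-covers u u≢r = Any.map (λ {B} e → subst (u ∈_) e (lookup⇒∈ (∈parentGroup u u≢r)))
    (∈phiGlo⇐ (par T u) (anyFin⇐ (lookup (childGroup T (par T u))) u (∈parentGroup u u≢r)))

  phiGlo-nonempty : All Nonempty (phiGlo T)
  phiGlo-nonempty = All.map (λ {B} → nonempty⇒ B)
    (AllP.all-filter (λ B → nonemptyB T B 𝔹.≟ true) (map (childGroup T) (allFin n)))

  phiGlo-disjoint : AllPairs (λ B C → Empty (B ∩ C)) (phiGlo T)
  phiGlo-disjoint = APP.filter⁺ _ (APP.map⁺ (AP.map (λ {v} {w} → childGroups-disjoint v w) (UP.allFin⁺ n)))

  phiGlo-avoids-root : All (λ B → r ∉ B) (phiGlo T)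
  phiGlo-avoids-root = AllP.filter⁺ (λ B → nonemptyB T B 𝔹.≟ true) {xs = map (childGroup T) (allFin n)}
    (AllP.map⁺ (All.tabulate {xs = allFin n} (λ {v} _ → root∉childGroup v)))

  phiGlo-partition : ∀ k → InTrees k T → IsPartition r k (phiGlo T)
  phiGlo-partition k #blocks = phiGlo-nonempty , phiGlo-disjoint , phiGlo-avoids-root , phiGlo-covers , #blocks

  #internal-full : ∀ k → InTrees k T → #internal full ≡ k
  #internal-full k #blocks = trans (sym length-phiGlo) #blocks

  psi-sequence : ∀ k → InTrees k T → IsSeq r k (psi T k)
  psi-sequence k #blocks = distinct , ends-in-root
    where open InternalListing (psi-spec k full full-closed (#internal-full k #blocks))

  -- blocks of size i ≥ 1 are exactly the child-groups of size i
  indegree-type : ∀ i → 1 ≤ i → indegMult T i ≡ typeMult (phiGlo T) i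
  indegree-type i 1≤i = sym (begin
    length (filter size≟i (phiGlo T))
      ≡⟨ length-filter-filter size≟i (λ B → nonemptyB T B 𝔹.≟ true) (map (childGroup T) (allFin n))
           (λ B e → size⇒nonempty B i 1≤i e) ⟩
    length (filter size≟i (map (childGroup T) (allFin n)))
      ≡⟨ length-filter-map size≟i (childGroup T) (allFin n) ⟩
    indegMult T i ∎)
    where
    open ≡-Reasoning
    size≟i : (B : Subset n) → Dec (∣ B ∣ ≡ i)
    size≟i B = ∣ B ∣ ℕ.≟ i

-- §7 Injectivity: φ_glo and ψ determine the parent map

leafGroup-transfer : ∀ {n} {r : Fin n} (T T′ : RTree n r) → (∀ B → B ∈L phiGlo T → B ∈L phiGlo T′) →
  ∀ A → Peeling.ParentClosed T′ A → (∀ x → hasChildIn T A x ≡ hasChildIn T′ A x) →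
  ∀ p → leafGroupAt T A p ≡ true →
  Σ (Fin _) (λ w → leafGroupAt T′ A w ≡ true × (∀ u → childIn T A p u ≡ childIn T′ A w u))
leafGroup-transfer {n} T T′ blocks⊆ A closed′ sameInternal p lg
  with Tree.hasChild⇒ T A p (proj₁ (Tree.leafGroup⇒ T A p lg))
... | y , cy with Tree.childIn⇒ T A p y cy
...   | y∈A , p∈A , y≢r , py≡p
  with Blocks.∈phiGlo⇒ T′ (childGroup T p) (blocks⊆ _ (Blocks.∈phiGlo⇐ T p (anyFin⇐ (lookup (childGroup T p)) y
         (trans (Blocks.childGroup-lookup T p y) (Tree.isChild⇐ T y p y≢r py≡p)))))
...     | w , group≡ , _ = w , lgw , sameChildren
  where
  isChild-same : ∀ u → isChildB T u p ≡ isChildB T′ u w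
  isChild-same u = trans (sym (Blocks.childGroup-lookup T p u))
    (trans (cong (λ B → lookup B u) group≡) (Blocks.childGroup-lookup T′ w u))
  w∈A : lookup A w ≡ true
  w∈A = subst (λ z → lookup A z ≡ true)
    (proj₂ (Tree.isChild⇒ T′ y w (trans (sym (isChild-same y)) (Tree.isChild⇐ T y p y≢r py≡p)))) (closed′ y y∈A)
  sameChildren : ∀ u → childIn T A p u ≡ childIn T′ A w u
  sameChildren u = cong₂ (λ a b → lookup A u ∧ a ∧ b) (trans p∈A (sym w∈A)) (isChild-same u)
  lgw : leafGroupAt T′ A w ≡ true
  lgw = Tree.leafGroup⇐ T′ A w (Tree.hasChild⇐ T′ A w y (trans (sym (sameChildren y)) cy))
    (λ u cu → trans (sym (sameInternal u)) (proj₂ (Tree.leafGroup⇒ T A p lg) u (trans (sameChildren u) cu)))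

module Injectivity {n : ℕ} {r : Fin n} (T T′ : RTree n r)
  (blocks⊆ : ∀ B → B ∈L phiGlo T → B ∈L phiGlo T′) (blocks⊇ : ∀ B → B ∈L phiGlo T′ → B ∈L phiGlo T) where
  module P  = Peeling T
  module P′ = Peeling T′

  record Synchronous (m : ℕ) (A : Subset n) : Set where
    field
      closed   : P.ParentClosed A
      closed′  : P′.ParentClosed A
      #A       : P.#internal A ≡ m
      #A′      : P′.#internal A ≡ m
      same-psi : psiFrom T m A ≡ psiFrom T′ m A

  module _ {m : ℕ} {A : Subset n} (S : Synchronous m A) where
    open Synchronous S

    -- equal outputs list the same internal vertices
    same-internal : ∀ x → hasChildIn T A x ≡ hasChildIn T′ A x
    same-internal x = bool-iff
      (λ h → L′.listed⇒internal x (subst (λ s → x ∈L toList s) same-psi (L.internal⇒listed x h)))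
      (λ h → L.listed⇒internal x (subst (λ s → x ∈L toList s) (sym same-psi) (L′.internal⇒listed x h)))
      where
      module L  = P.InternalListing (P.psi-spec m A closed #A)
      module L′ = P′.InternalListing (P′.psi-spec m A closed′ #A′)

    -- if both procedures pick p next, they delete the same group: the
    -- transferred groups have equal maxima, so both are the group of p
    same-group : ∀ p → largestLGParent T A ≡ just p → largestLGParent T′ A ≡ just p →
      ∀ u → childIn T A p u ≡ childIn T′ A p u
    same-group p eq eq′ u = trans (children≡ u) (cong (λ z → childIn T′ A z u) w≡p)
      where
      lg  = proj₁ (Tree.largest-just T A p eq)
      lg′ = proj₁ (Tree.largest-just T′ A p eq′)
      transferred : Σ (Fin n) (λ w → leafGroupAt T′ A w ≡ true × (∀ u → childIn T A p u ≡ childIn T′ A w u))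
      transferred = leafGroup-transfer T T′ blocks⊆ A closed′ same-internal p lg
      transferred′ : Σ (Fin n) (λ w → leafGroupAt T A w ≡ true × (∀ u → childIn T′ A p u ≡ childIn T A w u))
      transferred′ = leafGroup-transfer T′ T blocks⊇ A closed (λ x → sym (same-internal x)) p lg′
      w = proj₁ transferred
      w′ = proj₁ transferred′
      children≡ : ∀ u → childIn T A p u ≡ childIn T′ A w u
      children≡ = proj₂ (proj₂ transferred)
      max≡ : maxChild T A p ≡ maxChild T′ A w
      max≡ = maxIndex-cong _ _ (allFin n) children≡
      max≡′ : maxChild T′ A p ≡ maxChild T A w′
      max≡′ = maxIndex-cong _ _ (allFin n) (proj₂ (proj₂ transferred′))
      p-max : maxChild T A p ≡ maxChild T′ A p
      p-max = ℕP.≤-antisym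
        (subst (_≤ maxChild T′ A p) (sym max≡) (proj₂ (Tree.largest-just T′ A p eq′) w (proj₁ (proj₂ transferred))))
        (subst (_≤ maxChild T A p) (sym max≡′) (proj₂ (Tree.largest-just T A p eq) w′ (proj₁ (proj₂ transferred′))))
      w≡p : w ≡ p
      w≡p = Tree.maxChild-injective T′ A w p
        (proj₁ (Tree.leafGroup⇒ T′ A w (proj₁ (proj₂ transferred)))) (proj₁ (Tree.leafGroup⇒ T′ A p lg′))
        (trans (sym max≡) p-max)

  agree : ∀ m A → Synchronous m A → ∀ u → lookup A u ≡ true → u ≢ r → par T u ≡ par T′ u
  agree zero A S u Au u≢r =
    ⊥-elim (true≢false (Tree.hasChild⇐ T A (par T u) u (Tree.childIn⇐ T A (par T u) u Au (closed u Au) u≢r refl))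
                       (count-zero _ (allFin n) #A (LMP.∈-allFin (par T u))))
    where open Synchronous S
  agree (suc m) A S
    with count-suc (hasChildIn T A) (allFin n) (Synchronous.#A S)
       | count-suc (hasChildIn T′ A) (allFin n) (Synchronous.#A′ S)
  ... | v , hv | v′ , hv′ with P.largest-exists A v hv | P′.largest-exists A v′ hv′
  ...   | p , eq | p′ , eq′
    with VP.∷-injective (trans (sym (Tree.psi-step T m A p eq)) (trans (Synchronous.same-psi S) (Tree.psi-step T′ m A p′ eq′)))
  ...     | refl , tails≡ = agree-step
    where
    open Synchronous S
    open P.Step A p (proj₁ (Tree.largest-just T A p eq))
    module S′ = P′.Step A p (proj₁ (Tree.largest-just T′ A p eq′))
    group≡ = same-group S p eq eq′
    A′≡ : A′ ≡ S′.A′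
    A′≡ = VP.tabulate-cong (λ u → cong (λ b → lookup A u ∧ not b) (group≡ u))
    next : Synchronous m A′
    next = record
      { closed   = stays-closed closed
      ; closed′  = subst P′.ParentClosed (sym A′≡) (S′.stays-closed closed′)
      ; #A       = ℕP.suc-injective (trans (sym internal-shrinks) #A)
      ; #A′      = subst (λ B → P′.#internal B ≡ m) (sym A′≡) (ℕP.suc-injective (trans (sym S′.internal-shrinks) #A′))
      ; same-psi = trans tails≡ (cong (psiFrom T′ m) (sym A′≡))
      }
    -- a deleted vertex has parent p in both trees; a survivor is handled by induction
    agree-step : ∀ u → lookup A u ≡ true → u ≢ r → par T u ≡ par T′ u
    agree-step u Au u≢r with bool-split (childIn T A p u)
    ... | inj₁ cu = trans (proj₂ (proj₂ (proj₂ (Tree.childIn⇒ T A p u cu))))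
                          (sym (proj₂ (proj₂ (proj₂ (Tree.childIn⇒ T′ A p u (trans (sym (group≡ u)) cu))))))
    ... | inj₂ cu = agree m A′ next u (survivor⇐ u Au cu) u≢r

injective : ∀ {n} {r : Fin n} k (T T′ : RTree n r) → InTrees k T → InTrees k T′ →
  phiGlo T ↭ phiGlo T′ → psi T k ≡ psi T′ k → (v : Fin n) → par T v ≡ par T′ v
injective {r = r} k T T′ #T #T′ φ≡ ψ≡ v with v ≟ r
... | yes refl = trans (parRoot T) (sym (parRoot T′))
... | no v≢r = Injectivity.agree T T′ blocks⊆ blocks⊇ k full start v (full-lookup v) v≢r
  where
  blocks⊆ : ∀ B → B ∈L phiGlo T → B ∈L phiGlo T′
  blocks⊆ B = PermP.∈-resp-↭ φ≡
  blocks⊇ : ∀ B → B ∈L phiGlo T′ → B ∈L phiGlo T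
  blocks⊇ B = PermP.∈-resp-↭ (↭-sym φ≡)
  start : Injectivity.Synchronous T T′ blocks⊆ blocks⊇ k full
  start = record
    { closed = Blocks.full-closed T ; closed′ = Blocks.full-closed T′
    ; #A = Blocks.#internal-full T k #T ; #A′ = Blocks.#internal-full T′ k #T′
    ; same-psi = ψ≡ }

-- §8 Surjectivity: decoding a partition and a sequence into a tree

-- P is a partition of [n]∖{r}
module Decoding {n : ℕ} {r : Fin n} (P : List (Subset n))
  (nonempty : All Nonempty P) (disjoint : AllPairs (λ B C → Empty (B ∩ C)) P)
  (avoids-root : All (λ B → r ∉ B) P) (covers : ∀ u → u ≢ r → Any (λ B → u ∈ B) P) where

  same-block : ∀ {B C} x → B ∈L P → C ∈L P → lookup B x ≡ true → lookup C x ≡ true → B ≡ C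
  same-block x B∈ C∈ Bx Cx with allPairs-lookup disjoint B∈ C∈
  ... | inj₁ B≡C        = B≡C
  ... | inj₂ (inj₁ B#C) = ⊥-elim (meet⇒⊥ _ _ x Bx Cx B#C)
  ... | inj₂ (inj₂ C#B) = ⊥-elim (meet⇒⊥ _ _ x Cx Bx C#B)

  root∉block : ∀ {B} → B ∈L P → lookup B r ≡ false
  root∉block {B} B∈ with bool-split (lookup B r)
  ... | inj₂ e = e
  ... | inj₁ e = ⊥-elim (All.lookup avoids-root B∈ (lookup⇒∈ e))

  blockOf : ∀ x → x ≢ r → Σ (Subset n) (λ B → B ∈L P × lookup B x ≡ true)
  blockOf x x≢r with find (covers x x≢r)
  ... | B , B∈ , x∈B = B , B∈ , ∈⇒lookup x∈B

  memberOf : ∀ {B} → B ∈L P → Σ (Fin n) (λ x → lookup B x ≡ true)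
  memberOf B∈ with All.lookup nonempty B∈
  ... | x , x∈B = x , ∈⇒lookup x∈B

  together : Fin n → Fin n → Bool
  together x u = any (λ B → lookup B x ∧ lookup B u) P

  together-block : ∀ {B} x u → B ∈L P → lookup B x ≡ true → together x u ≡ lookup B u
  together-block {B} x u B∈ Bx = bool-iff toB fromB
    where
    toB : together x u ≡ true → lookup B u ≡ true
    toB e with any⇒ (λ B → lookup B x ∧ lookup B u) P e
    ... | C , C∈ , Cxu with ∧-true {lookup C x} Cxu
    ...   | Cx , Cu with same-block x B∈ C∈ Bx Cx
    ...     | refl = Cu
    fromB : lookup B u ≡ true → together x u ≡ true
    fromB Bu = any⇐ (λ B → lookup B x ∧ lookup B u) B∈ (∧-intro Bx Bu)

  together⇒ : ∀ x u → together x u ≡ true → Σ (Subset n) (λ B → B ∈L P × lookup B x ≡ true × lookup B u ≡ true)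
  together⇒ x u e with any⇒ (λ B → lookup B x ∧ lookup B u) P e
  ... | C , C∈ , Cxu = C , C∈ , ∧-true Cxu

  together-nonroot : ∀ x u → together x u ≡ true → x ≢ r × u ≢ r
  together-nonroot x u e with together⇒ x u e
  ... | C , C∈ , Cx , Cu = (λ { refl → true≢false Cx (root∉block C∈) }) , (λ { refl → true≢false Cu (root∉block C∈) })

  together-trans : ∀ x y z → together x y ≡ true → together y z ≡ true → together x z ≡ true
  together-trans x y z xy yz with together⇒ x y xy
  ... | B , B∈ , Bx , By = trans (together-block x z B∈ Bx) (trans (sym (together-block y z B∈ By)) yz)

  together-sym : ∀ x y → together x y ≡ true → together y x ≡ true
  together-sym x y xy with together⇒ x y xy
  ... | B , B∈ , Bx , By = trans (together-block y x B∈ By) Bx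

  entryOf : ∀ {m} → Fin n → Vec (Fin n) m → Bool
  entryOf u q = any (λ x → ⌊ x ≟ u ⌋) (toList q)

  entryOf⇒ : ∀ {m} u (q : Vec (Fin n) m) → entryOf u q ≡ true → u ∈L toList q
  entryOf⇒ u q e with any⇒ (λ x → ⌊ x ≟ u ⌋) (toList q) e
  ... | x , x∈q , x≟u with ⌊⌋-true⇒ (x ≟ u) x≟u
  ...   | refl = x∈q

  entryOf⇐ : ∀ {m} u (q : Vec (Fin n) m) → u ∈L toList q → entryOf u q ≡ true
  entryOf⇐ u q u∈q = any⇐ (λ x → ⌊ x ≟ u ⌋) u∈q (⌊⌋-true⇐ (u ≟ u) refl)

  -- x is a non-root vertex of A whose block contains no entry of q; with q the
  -- remaining sequence, these blocks are the leaf-groups of the tree being rebuilt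
  eligible : ∀ {m} → Subset n → Vec (Fin n) m → Fin n → Bool
  eligible A q x = lookup A x ∧ not ⌊ x ≟ r ⌋ ∧ all (λ u → not (together x u ∧ entryOf u q)) (allFin n)

  eligible⇒ : ∀ {m} A (q : Vec (Fin n) m) x → eligible A q x ≡ true →
    lookup A x ≡ true × x ≢ r × (∀ u → together x u ≡ true → u ∈L toList q → ⊥)
  eligible⇒ A q x e with ∧-true {lookup A x} e
  ... | Ax , rest with ∧-true {not ⌊ x ≟ r ⌋} rest
  ...   | x≢r , avoids = Ax , ⌊⌋-false⇒ (x ≟ r) (not-true x≢r) ,
                         λ u xu u∈q → true≢false (∧-intro xu (entryOf⇐ u q u∈q)) (not-true (allFin⇒ _ avoids u))

  eligible⇐ : ∀ {m} A (q : Vec (Fin n) m) x → lookup A x ≡ true → x ≢ r →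
    (∀ u → together x u ≡ true → u ∈L toList q → ⊥) → eligible A q x ≡ true
  eligible⇐ A q x Ax x≢r avoids =
    ∧-intro Ax (∧-intro (not-false (⌊⌋-false⇐ (x ≟ r) x≢r)) (allFin⇐ _ λ u → not-false (notBoth u)))
    where
    notBoth : ∀ u → (together x u ∧ entryOf u q) ≡ false
    notBoth u with bool-split (together x u) | bool-split (entryOf u q)
    ... | inj₂ xu | _ rewrite xu = refl
    ... | inj₁ xu | inj₂ u∉q rewrite xu | u∉q = refl
    ... | inj₁ xu | inj₁ u∈q = ⊥-elim (avoids u xu (entryOf⇒ u q u∈q))

  blockAt : Maybe (Fin n) → Fin n → Bool
  blockAt (just x) u = together x u
  blockAt nothing  u = false

  nextBlock : ∀ {m} → Subset n → Vec (Fin n) m → Fin n → Bool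
  nextBlock A q = blockAt (largestWith (eligible A q))

  remove : Subset n → (Fin n → Bool) → Subset n
  remove A c = tabulate (λ u → lookup A u ∧ not (c u))

  decode : ∀ m → Subset n → Vec (Fin n) m → Fin n → Fin n
  decode zero    A []      u = r
  decode (suc m) A (p ∷ q) u = if nextBlock A (p ∷ q) u then p else decode m (remove A (nextBlock A (p ∷ q))) q u

  meets : Subset n → Subset n → Bool
  meets A B = any (λ u → lookup B u ∧ lookup A u) (allFin n)

  record Decodable {m} (A : Subset n) (q : Vec (Fin n) m) : Set where
    field
      union-of-blocks : ∀ x u → lookup A x ≡ true → together x u ≡ true → lookup A u ≡ true
      distinct        : Unique (toList q)
      ends-in-root    : ∀ i → suc (toℕ i) ≡ m → lookup q i ≡ r
      entries-in-A    : ∀ x → x ∈L toList q → lookup A x ≡ true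
      #blocks         : count (meets A) P ≡ m

  only-root : ∀ A → Decodable A [] → ∀ u → lookup A u ≡ true → u ≡ r
  only-root A D u Au with u ≟ r
  ... | yes u≡r = u≡r
  ... | no u≢r with blockOf u u≢r
  ...   | B , B∈ , Bu = ⊥-elim (true≢false (anyFin⇐ (λ v → lookup B v ∧ lookup A v) u (∧-intro Bu Au))
                                          (count-zero (meets A) P (Decodable.#blocks D) B∈))

  module DecodeStep {m : ℕ} (A : Subset n) (p : Fin n) (q : Vec (Fin n) m) (D : Decodable A (p ∷ q)) where
    open Decodable D

    -- the non-root entries of p ∷ q are fewer than the m + 1 blocks meeting A
    inner : List (Fin n)
    inner = filter (λ y → ¬? (y ≟ r)) (toList (p ∷ q))

    inner-short : length inner < suc m
    inner-short = subst (length inner <_) (VP.length-toList (p ∷ q))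
      (LP.filter-notAll (λ y → ¬? (y ≟ r)) (toList (p ∷ q)) (Any.map (λ e r≢y → r≢y (sym e)) r∈))
      where
      r∈ : r ∈L toList (p ∷ q)
      r∈ = subst (_∈L toList (p ∷ q)) (ends-in-root (F.fromℕ m) (cong suc (FP.toℕ-fromℕ m)))
                 (VMP.∈-toList⁺ (VMP.∈-lookup (F.fromℕ m) (p ∷ q)))

    -- by pigeonhole some block meeting A avoids the sequence
    eligible-exists : Σ (Fin n) (λ x → eligible A (p ∷ q) x ≡ true)
    eligible-exists with meets-or-avoids (meets A) P inner
    ... | inj₁ allMeet = ⊥-elim (ℕP.<-irrefl refl
            (ℕP.≤-<-trans (subst (_≤ length inner) #blocks (pigeonhole (meets A) P inner disjoint allMeet)) inner-short))
    ... | inj₂ (B , B∈ , BmeetsA , avoids) with anyFin⇒ (λ u → lookup B u ∧ lookup A u) BmeetsA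
    ...   | x , BxAx with ∧-true {lookup B x} BxAx
    ...     | Bx , Ax = x , eligible⇐ A (p ∷ q) x Ax (λ { refl → true≢false Bx (root∉block B∈) }) notListed
      where
      notListed : ∀ u → together x u ≡ true → u ∈L toList (p ∷ q) → ⊥
      notListed u xu u∈ with u ≟ r
      ... | yes refl = proj₂ (together-nonroot x r xu) refl
      ... | no u≢r = true≢false (trans (sym (together-block x u B∈ Bx)) xu)
                                (avoids u (LMP.∈-filter⁺ (λ y → ¬? (y ≟ r)) u∈ u≢r))

    top-exists : Σ (Fin n) (λ x → largestWith (eligible A (p ∷ q)) ≡ just x)
    top-exists with largestWith (eligible A (p ∷ q)) in eq
    ... | just x  = x , refl
    ... | nothing = ⊥-elim (true≢false (proj₂ eligible-exists)
                                       (largestWith-nothing (eligible A (p ∷ q)) eq (proj₁ eligible-exists)))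

    top : Fin n
    top = proj₁ top-exists

    top-largest : eligible A (p ∷ q) top ≡ true × (∀ y → eligible A (p ∷ q) y ≡ true → toℕ y ≤ toℕ top)
    top-largest = largestWith-just (eligible A (p ∷ q)) top (proj₂ top-exists)

    top∈A : lookup A top ≡ true
    top∈A = proj₁ (eligible⇒ A (p ∷ q) top (proj₁ top-largest))

    top≢r : top ≢ r
    top≢r = proj₁ (proj₂ (eligible⇒ A (p ∷ q) top (proj₁ top-largest)))

    topBlock : Subset n
    topBlock = proj₁ (blockOf top top≢r)

    topBlock∈ : topBlock ∈L P
    topBlock∈ = proj₁ (proj₂ (blockOf top top≢r))

    top∈topBlock : lookup topBlock top ≡ true
    top∈topBlock = proj₂ (proj₂ (blockOf top top≢r))

    chosen : Fin n → Bool
    chosen = nextBlock A (p ∷ q)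

    chosen-together : ∀ u → chosen u ≡ together top u
    chosen-together u = cong (λ t → blockAt t u) (proj₂ top-exists)

    chosen-block : ∀ u → chosen u ≡ lookup topBlock u
    chosen-block u = trans (chosen-together u) (together-block top u topBlock∈ top∈topBlock)

    chosen⊆A : ∀ u → chosen u ≡ true → lookup A u ≡ true
    chosen⊆A u c = union-of-blocks top u top∈A (trans (sym (chosen-together u)) c)

    chosen-unlisted : ∀ u → chosen u ≡ true → u ∈L toList (p ∷ q) → ⊥
    chosen-unlisted u c = proj₂ (proj₂ (eligible⇒ A (p ∷ q) top (proj₁ top-largest))) u (trans (sym (chosen-together u)) c)

    listed-unchosen : ∀ u → u ∈L toList (p ∷ q) → chosen u ≡ false
    listed-unchosen u u∈ with bool-split (chosen u)
    ... | inj₂ c = c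
    ... | inj₁ c = ⊥-elim (chosen-unlisted u c u∈)

    top-chosen : chosen top ≡ true
    top-chosen = trans (chosen-block top) top∈topBlock

    chosen-nonroot : ∀ u → chosen u ≡ true → u ≢ r
    chosen-nonroot u c = proj₂ (together-nonroot top u (trans (sym (chosen-together u)) c))

    A′ : Subset n
    A′ = remove A chosen

    remove-lookup : ∀ u → lookup A′ u ≡ (lookup A u ∧ not (chosen u))
    remove-lookup u = VP.lookup∘tabulate (λ u → lookup A u ∧ not (chosen u)) u

    survivor⇒ : ∀ u → lookup A′ u ≡ true → lookup A u ≡ true × chosen u ≡ false
    survivor⇒ u e with ∧-true {lookup A u} (trans (sym (remove-lookup u)) e)
    ... | Au , notChosen = Au , not-true notChosen

    survivor⇐ : ∀ u → lookup A u ≡ true → chosen u ≡ false → lookup A′ u ≡ true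
    survivor⇐ u Au c = trans (remove-lookup u) (∧-intro Au (not-false c))

    meets-unchanged : ∀ B → B ∈L P → B ≢ topBlock → meets A B ≡ meets A′ B
    meets-unchanged B B∈ B≢top = bool-iff toA′ toA
      where
      toA′ : meets A B ≡ true → meets A′ B ≡ true
      toA′ e with anyFin⇒ (λ u → lookup B u ∧ lookup A u) e
      ... | u , BuAu with ∧-true {lookup B u} BuAu
      ...   | Bu , Au = anyFin⇐ (λ u → lookup B u ∧ lookup A′ u) u (∧-intro Bu (survivor⇐ u Au unchosen))
        where
        unchosen : chosen u ≡ false
        unchosen with bool-split (chosen u)
        ... | inj₂ c = c
        ... | inj₁ c = ⊥-elim (B≢top (same-block u B∈ topBlock∈ Bu (trans (sym (chosen-block u)) c)))
      toA : meets A′ B ≡ true → meets A B ≡ true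
      toA e with anyFin⇒ (λ u → lookup B u ∧ lookup A′ u) e
      ... | u , BuA′u with ∧-true {lookup B u} BuA′u
      ...   | Bu , A′u = anyFin⇐ (λ u → lookup B u ∧ lookup A u) u (∧-intro Bu (proj₁ (survivor⇒ u A′u)))

    topBlock-meets : meets A topBlock ≡ true
    topBlock-meets = anyFin⇐ (λ u → lookup topBlock u ∧ lookup A u) top (∧-intro top∈topBlock top∈A)

    topBlock-gone : meets A′ topBlock ≡ false
    topBlock-gone with bool-split (meets A′ topBlock)
    ... | inj₂ e = e
    ... | inj₁ e with anyFin⇒ (λ u → lookup topBlock u ∧ lookup A′ u) e
    ...   | u , BuA′u with ∧-true {lookup topBlock u} BuA′u
    ...     | Bu , A′u = ⊥-elim (true≢false (trans (chosen-block u) Bu) (proj₂ (survivor⇒ u A′u)))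

    decodable′ : Decodable A′ q
    decodable′ = record
      { union-of-blocks = λ x u A′x xu → survivor⇐ u (union-of-blocks x u (proj₁ (survivor⇒ x A′x)) xu) (unchosen x u A′x xu)
      ; distinct        = AP.tail distinct
      ; ends-in-root    = λ i e → ends-in-root (F.suc i) (cong suc e)
      ; entries-in-A    = λ x x∈ → survivor⇐ x (entries-in-A x (there x∈)) (listed-unchosen x (there x∈))
      ; #blocks         = ℕP.suc-injective (trans (sym (count-step (meets A) (meets A′) topBlock P (disjoint⇒distinct P nonempty disjoint)
                            topBlock∈ topBlock-meets topBlock-gone meets-unchanged)) #blocks)
      }
      where
      unchosen : ∀ x u → lookup A′ x ≡ true → together x u ≡ true → chosen u ≡ false
      unchosen x u A′x xu with bool-split (chosen u)
      ... | inj₂ c = c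
      ... | inj₁ c = ⊥-elim (true≢false (trans (chosen-together x)
                      (together-trans top u x (trans (sym (chosen-together u)) c) (together-sym x u xu))) (proj₂ (survivor⇒ x A′x)))

    decode-chosen : ∀ u → chosen u ≡ true → decode (suc m) A (p ∷ q) u ≡ p
    decode-chosen u c rewrite c = refl

    decode-other : ∀ u → chosen u ≡ false → decode (suc m) A (p ∷ q) u ≡ decode m A′ q u
    decode-other u c rewrite c = refl

  Agrees : ∀ {m} → (Fin n → Fin n) → Subset n → Vec (Fin n) m → Set
  Agrees {m} f A q = ∀ u → lookup A u ≡ true → u ≢ r → f u ≡ decode m A q u

  agrees-step : ∀ {m} {A p} {q : Vec (Fin n) m} (D : Decodable A (p ∷ q)) (f : Fin n → Fin n) →
    Agrees f A (p ∷ q) → Agrees f (DecodeStep.A′ A p q D) q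
  agrees-step {A = A} {p} {q} D f agrees u A′u u≢r =
    trans (agrees u (proj₁ (survivor⇒ u A′u)) u≢r) (decode-other u (proj₂ (survivor⇒ u A′u)))
    where open DecodeStep A p q D

  decode-listed : ∀ m A (q : Vec (Fin n) m) → Decodable A q → ∀ u → lookup A u ≡ true → u ≢ r →
    decode m A q u ∈L toList q
  decode-listed zero    A []      D u Au u≢r = ⊥-elim (u≢r (only-root A D u Au))
  decode-listed (suc m) A (p ∷ q) D u Au u≢r with bool-split (DecodeStep.chosen A p q D u)
  ... | inj₁ c = subst (_∈L toList (p ∷ q)) (sym (decode-chosen u c)) (here refl)
    where open DecodeStep A p q D
  ... | inj₂ c = subst (_∈L toList (p ∷ q)) (sym (decode-other u c))
                   (there (decode-listed m A′ q decodable′ u (survivor⇐ u Au c) u≢r))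
    where open DecodeStep A p q D

  decode-head⇒chosen : ∀ m A p (q : Vec (Fin n) m) (D : Decodable A (p ∷ q)) → ∀ u → lookup A u ≡ true → u ≢ r →
    decode (suc m) A (p ∷ q) u ≡ p → DecodeStep.chosen A p q D u ≡ true
  decode-head⇒chosen m A p q D u Au u≢r e with bool-split (DecodeStep.chosen A p q D u)
  ... | inj₁ c = c
  ... | inj₂ c = ⊥-elim (All.lookup (AP.head distinct) p∈q refl)
    where
    open DecodeStep A p q D
    open Decodable D using (distinct)
    p∈q : p ∈L toList q
    p∈q = subst (_∈L toList q) (trans (sym (decode-other u c)) e) (decode-listed m A′ q decodable′ u (survivor⇐ u Au c) u≢r)

  decode-onto : ∀ m A (q : Vec (Fin n) m) → Decodable A q → ∀ x → x ∈L toList q →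
    Σ (Fin n) (λ u → lookup A u ≡ true × u ≢ r × decode m A q u ≡ x)
  decode-onto (suc m) A (p ∷ q) D x (here refl) = top , top∈A , top≢r , decode-chosen top top-chosen
    where open DecodeStep A p q D
  decode-onto (suc m) A (p ∷ q) D x (there x∈q) with decode-onto m (DecodeStep.A′ A p q D) q (DecodeStep.decodable′ A p q D) x x∈q
  ... | u , A′u , u≢r , e = u , proj₁ (survivor⇒ u A′u) , u≢r , trans (decode-other u (proj₂ (survivor⇒ u A′u))) e
    where open DecodeStep A p q D

  decode-blockwise : ∀ m A (q : Vec (Fin n) m) → Decodable A q → ∀ u w → lookup A u ≡ true → together u w ≡ true →
    decode m A q u ≡ decode m A q w
  decode-blockwise zero    A []      D u w Au uw = refl
  decode-blockwise (suc m) A (p ∷ q) D u w Au uw with bool-split (DecodeStep.chosen A p q D u)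
  ... | inj₁ c = trans (decode-chosen u c) (sym (decode-chosen w wc))
    where
    open DecodeStep A p q D
    wc : chosen w ≡ true
    wc = trans (chosen-together w) (together-trans top u w (trans (sym (chosen-together u)) c) uw)
  ... | inj₂ c = trans (decode-other u c) (trans (decode-blockwise m A′ q decodable′ u w (survivor⇐ u Au c) uw) (sym (decode-other w wc)))
    where
    open DecodeStep A p q D
    wc : chosen w ≡ false
    wc with bool-split (chosen w)
    ... | inj₂ z = z
    ... | inj₁ z = ⊥-elim (true≢false (trans (chosen-together u)
                     (together-trans top w u (trans (sym (chosen-together w)) z) (together-sym u w uw))) c)

  decode-reaches-root : ∀ m A (q : Vec (Fin n) m) → Decodable A q → (f : Fin n → Fin n) → f r ≡ r →
    Agrees f A q → ∀ u → lookup A u ≡ true → iter f m u ≡ r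
  decode-reaches-root zero    A []      D f fr agrees u Au = only-root A D u Au
  decode-reaches-root (suc m) A (p ∷ q) D f fr agrees u Au with u ≟ r
  ... | yes refl = iter-fix f (suc m) r fr
  ... | no u≢r with bool-split (DecodeStep.chosen A p q D u)
  ...   | inj₁ c = trans (cong (iter f m) (trans (agrees u Au u≢r) (decode-chosen u c)))
                         (decode-reaches-root m A′ q decodable′ f fr (agrees-step D f agrees) p
                            (survivor⇐ p (entries-in-A p (here refl)) (listed-unchosen p (here refl))))
    where
    open DecodeStep A p q D
    open Decodable D using (entries-in-A)
  ...   | inj₂ c = trans (iter-suc f m u)
                         (trans (cong f (decode-reaches-root m A′ q decodable′ f fr (agrees-step D f agrees) u (survivor⇐ u Au c))) fr)
    where open DecodeStep A p q D

  fibre-block : ∀ m A (q : Vec (Fin n) m) → Decodable A q → ∀ x → x ∈L toList q →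
    Σ (Subset n) (λ B → B ∈L P ×
      (∀ u → lookup B u ≡ true → lookup A u ≡ true × u ≢ r × decode m A q u ≡ x) ×
      (∀ u → lookup A u ≡ true → u ≢ r → decode m A q u ≡ x → lookup B u ≡ true))
  fibre-block (suc m) A (p ∷ q) D x (here refl) = topBlock , topBlock∈ , toFibre , fromFibre
    where
    open DecodeStep A p q D
    toFibre : ∀ u → lookup topBlock u ≡ true → lookup A u ≡ true × u ≢ r × decode (suc m) A (p ∷ q) u ≡ p
    toFibre u Bu = chosen⊆A u c , chosen-nonroot u c , decode-chosen u c
      where c = trans (chosen-block u) Bu
    fromFibre : ∀ u → lookup A u ≡ true → u ≢ r → decode (suc m) A (p ∷ q) u ≡ p → lookup topBlock u ≡ true
    fromFibre u Au u≢r e = trans (sym (chosen-block u)) (decode-head⇒chosen m A p q D u Au u≢r e)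
  fibre-block (suc m) A (p ∷ q) D x (there x∈q)
    with fibre-block m (DecodeStep.A′ A p q D) q (DecodeStep.decodable′ A p q D) x x∈q
  ... | B , B∈ , toFibre′ , fromFibre′ = B , B∈ , toFibre , fromFibre
    where
    open DecodeStep A p q D
    open Decodable D using (distinct)
    p≢x : p ≢ x
    p≢x refl = All.lookup (AP.head distinct) x∈q refl
    toFibre : ∀ u → lookup B u ≡ true → lookup A u ≡ true × u ≢ r × decode (suc m) A (p ∷ q) u ≡ x
    toFibre u Bu with toFibre′ u Bu
    ... | A′u , u≢r , e = proj₁ (survivor⇒ u A′u) , u≢r , trans (decode-other u (proj₂ (survivor⇒ u A′u))) e
    fromFibre : ∀ u → lookup A u ≡ true → u ≢ r → decode (suc m) A (p ∷ q) u ≡ x → lookup B u ≡ true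
    fromFibre u Au u≢r e with bool-split (chosen u)
    ... | inj₁ c = ⊥-elim (p≢x (trans (sym (decode-chosen u c)) e))
    ... | inj₂ c = fromFibre′ u (survivor⇐ u Au c) u≢r (trans (sym (decode-other u c)) e)

  module Rebuild (k : ℕ) (s : Vec (Fin n) k) (D₀ : Decodable full s) (k≤n : k ≤ n) where

    parent : Fin n → Fin n
    parent u = if ⌊ u ≟ r ⌋ then r else decode k full s u

    parent-root : parent r ≡ r
    parent-root rewrite ⌊⌋-true⇐ (r ≟ r) refl = refl

    parent-agrees : Agrees parent full s
    parent-agrees u _ u≢r rewrite ⌊⌋-false⇐ (u ≟ r) u≢r = refl

    -- k steps reach the root, and the root is fixed for the remaining n ∸ k
    reaches : ∀ v → iter parent n v ≡ r
    reaches v = begin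
      iter parent n v                           ≡⟨ cong (λ t → iter parent t v) (sym (ℕP.m+[n∸m]≡n k≤n)) ⟩
      iter parent (k + (n ∸ k)) v               ≡⟨ iter-+ parent k (n ∸ k) v ⟩
      iter parent (n ∸ k) (iter parent k v)     ≡⟨ cong (iter parent (n ∸ k))
                                                     (decode-reaches-root k full s D₀ parent parent-root parent-agrees v (full-lookup v)) ⟩
      iter parent (n ∸ k) r                     ≡⟨ iter-fix parent (n ∸ k) r parent-root ⟩
      r ∎
      where open ≡-Reasoning

    tree : RTree n r
    tree = record { par = parent ; parRoot = parent-root ; reach = reaches }

    open Tree tree

    module RetraceStep {m : ℕ} (A : Subset n) (p : Fin n) (q : Vec (Fin n) m)
      (D : Decodable A (p ∷ q)) (agrees : Agrees parent A (p ∷ q)) where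
      open DecodeStep A p q D
      open Decodable D using (union-of-blocks; entries-in-A)

      childIn-decode : ∀ v u → childIn tree A v u ≡ true →
        lookup A u ≡ true × lookup A v ≡ true × u ≢ r × decode (suc m) A (p ∷ q) u ≡ v
      childIn-decode v u c with childIn⇒ A v u c
      ... | Au , Av , u≢r , e = Au , Av , u≢r , trans (sym (agrees u Au u≢r)) e

      children-of-head : ∀ u → childIn tree A p u ≡ chosen u
      children-of-head u = bool-iff toChosen fromChosen
        where
        toChosen : childIn tree A p u ≡ true → chosen u ≡ true
        toChosen c with childIn-decode p u c
        ... | Au , _ , u≢r , e = decode-head⇒chosen m A p q D u Au u≢r e
        fromChosen : chosen u ≡ true → childIn tree A p u ≡ true
        fromChosen c = childIn⇐ A p u (chosen⊆A u c) (entries-in-A p (here refl)) (chosen-nonroot u c)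
                         (trans (agrees u (chosen⊆A u c) (chosen-nonroot u c)) (decode-chosen u c))

      internal⇒listed : ∀ v → hasChildIn tree A v ≡ true → v ∈L toList (p ∷ q)
      internal⇒listed v h with hasChild⇒ A v h
      ... | u , c with childIn-decode v u c
      ...   | Au , _ , u≢r , e = subst (_∈L toList (p ∷ q)) e (decode-listed (suc m) A (p ∷ q) D u Au u≢r)

      listed⇒internal : ∀ v → v ∈L toList (p ∷ q) → hasChildIn tree A v ≡ true
      listed⇒internal v v∈ with decode-onto (suc m) A (p ∷ q) D v v∈
      ... | u , Au , u≢r , e = hasChild⇐ A v u (childIn⇐ A v u Au (entries-in-A v v∈) u≢r (trans (agrees u Au u≢r) e))

      head-leafGroup : leafGroupAt tree A p ≡ true
      head-leafGroup = leafGroup⇐ A p (hasChild⇐ A p top (trans (children-of-head top) top-chosen))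
        (λ u cu → leaf u (trans (sym (children-of-head u)) cu))
        where
        leaf : ∀ u → chosen u ≡ true → hasChildIn tree A u ≡ false
        leaf u c with bool-split (hasChildIn tree A u)
        ... | inj₂ z = z
        ... | inj₁ z = ⊥-elim (chosen-unlisted u c (internal⇒listed u z))

      -- every other leaf-group consists of eligible vertices below top
      others-smaller : ∀ v → v ≢ p → leafGroupAt tree A v ≡ true → maxChild tree A v < maxChild tree A p
      others-smaller v v≢p lgv with maxChild-attained A v (proj₁ (leafGroup⇒ A v lgv))
      ... | y , cy , maxv with childIn-decode v y cy
      ...   | Ay , Av , y≢r , ydec = subst (_< maxChild tree A p) (sym maxv)
               (ℕP.≤-trans (s≤s y<top) (maxChild-ub A p top (trans (children-of-head top) top-chosen)))
        where
        eligible-y : eligible A (p ∷ q) y ≡ true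
        eligible-y = eligible⇐ A (p ∷ q) y Ay y≢r avoids
          where
          avoids : ∀ u → together y u ≡ true → u ∈L toList (p ∷ q) → ⊥
          avoids u yu u∈ = true≢false (listed⇒internal u u∈) (proj₂ (leafGroup⇒ A v lgv) u cu)
            where
            Au = union-of-blocks y u Ay yu
            u≢r = proj₂ (together-nonroot y u yu)
            cu : childIn tree A v u ≡ true
            cu = childIn⇐ A v u Au Av u≢r
                   (trans (agrees u Au u≢r) (trans (sym (decode-blockwise (suc m) A (p ∷ q) D y u Ay yu)) ydec))
        y≢top : y ≢ top
        y≢top refl = v≢p (trans (sym ydec) (decode-chosen top top-chosen))
        y<top : toℕ y < toℕ top
        y<top = ℕP.≤∧≢⇒< (proj₂ top-largest y eligible-y) (λ e → y≢top (FP.toℕ-injective e))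

      selects-head : largestLGParent tree A ≡ just p
      selects-head with largestLGParent tree A in eq
      ... | nothing = ⊥-elim (true≢false head-leafGroup (largest-nothing A eq p))
      ... | just p′ with p′ ≟ p
      ...   | yes refl = refl
      ...   | no p′≢p with largest-just A p′ eq
      ...     | lg′ , max = ⊥-elim (ℕP.<-irrefl refl (ℕP.<-≤-trans (others-smaller p′ p′≢p lg′) (max p head-leafGroup)))

      deletes-chosen : deleteGroup tree A p ≡ A′
      deletes-chosen = VP.tabulate-cong (λ u → cong (λ b → lookup A u ∧ not b) (children-of-head u))

    retrace : ∀ m A (q : Vec (Fin n) m) → Decodable A q → Agrees parent A q → psiFrom tree m A ≡ q
    retrace zero    A []      D agrees = refl
    retrace (suc m) A (p ∷ q) D agrees = begin
      psiFrom tree (suc m) A                 ≡⟨ psi-step m A p selects-head ⟩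
      p ∷ psiFrom tree m (deleteGroup tree A p) ≡⟨ cong (λ B → p ∷ psiFrom tree m B) deletes-chosen ⟩
      p ∷ psiFrom tree m A′                  ≡⟨ cong (p ∷_) (retrace m A′ q decodable′ (agrees-step D parent agrees)) ⟩
      p ∷ q ∎
      where
      open ≡-Reasoning
      open RetraceStep A p q D agrees
      open DecodeStep A p q D using (A′; decodable′)

    psi-tree : psi tree k ≡ s
    psi-tree = retrace k full s D₀ parent-agrees

    childGroup-block : ∀ v → v ∈L toList s → Σ (Subset n) (λ B → B ∈L P × childGroup tree v ≡ B)
    childGroup-block v v∈ with fibre-block k full s D₀ v v∈
    ... | B , B∈ , toFibre , fromFibre =
      B , B∈ , vec-ext _ _ (λ u → trans (Blocks.childGroup-lookup tree v u) (bool-iff (toB u) (fromB u)))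
      where
      toB : ∀ u → isChildB tree u v ≡ true → lookup B u ≡ true
      toB u c with isChild⇒ u v c
      ... | u≢r , e = fromFibre u (full-lookup u) u≢r (trans (sym (parent-agrees u (full-lookup u) u≢r)) e)
      fromB : ∀ u → lookup B u ≡ true → isChildB tree u v ≡ true
      fromB u Bu with toFibre u Bu
      ... | _ , u≢r , e = isChild⇐ u v u≢r (trans (parent-agrees u (full-lookup u) u≢r) e)

    decoded-parent-listed : ∀ u → u ≢ r → parent u ∈L toList s
    decoded-parent-listed u u≢r = subst (_∈L toList s) (sym (parent-agrees u (full-lookup u) u≢r))
      (decode-listed k full s D₀ u (full-lookup u) u≢r)

    blocks⊆P : ∀ B → B ∈L phiGlo tree → B ∈L P
    blocks⊆P B B∈ with Blocks.∈phiGlo⇒ tree B B∈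
    ... | v , refl , nonemptyB with anyFin⇒ (lookup (childGroup tree v)) nonemptyB
    ...   | u , u∈ with isChild⇒ u v (trans (sym (Blocks.childGroup-lookup tree v u)) u∈)
    ...     | u≢r , refl with childGroup-block (parent u) (decoded-parent-listed u u≢r)
    ...       | B₀ , B₀∈ , group≡ = subst (_∈L P) (sym group≡) B₀∈

    P⊆blocks : ∀ B → B ∈L P → B ∈L phiGlo tree
    P⊆blocks B B∈ with memberOf B∈
    ... | u , Bu = subst (_∈L phiGlo tree) (sym B≡)
                     (Blocks.∈phiGlo⇐ tree (parent u) (anyFin⇐ (lookup (childGroup tree (parent u))) u u∈group))
      where
      u≢r : u ≢ r
      u≢r refl = true≢false Bu (root∉block B∈)
      u∈group : lookup (childGroup tree (parent u)) u ≡ true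
      u∈group = Blocks.∈parentGroup tree u u≢r
      B≡ : B ≡ childGroup tree (parent u)
      B≡ with childGroup-block (parent u) (decoded-parent-listed u u≢r)
      ... | B₀ , B₀∈ , group≡ = trans (same-block u B∈ B₀∈ Bu (subst (λ C → lookup C u ≡ true) group≡ u∈group)) (sym group≡)

    -- both lists are duplicate-free, so they are permutations of each other
    phiGlo↭P : phiGlo tree ↭ P
    phiGlo↭P = ∼bag⇒↭ (unique∧set⇒bag
      (disjoint⇒distinct (phiGlo tree) (Blocks.phiGlo-nonempty tree) (Blocks.phiGlo-disjoint tree))
      (disjoint⇒distinct P nonempty disjoint)
      (λ {B} → mk⇔ (blocks⊆P B) (P⊆blocks B)))

surjective : ∀ {n} {r : Fin n} k → k ≤ n → (P : List (Subset n)) → IsPartition r k P →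
  (s : Vec (Fin n) k) → IsSeq r k s → Σ (RTree n r) (λ T → InTrees k T × (phiGlo T ↭ P) × (psi T k ≡ s))
surjective {n} k k≤n P (nonempty , disjoint , avoids-root , covers , #P) s (distinct , ends-in-root) =
  tree , trans (PermP.↭-length phiGlo↭P) #P , phiGlo↭P , psi-tree
  where
  open Decoding P nonempty disjoint avoids-root covers
  every-block-meets : ∀ B → B ∈L P → meets full B ≡ true
  every-block-meets B B∈ with memberOf B∈
  ... | u , Bu = anyFin⇐ (λ v → lookup B v ∧ lookup full v) u (∧-intro Bu (full-lookup u))
  start : Decodable full s
  start = record
    { union-of-blocks = λ _ u _ _ → full-lookup u
    ; distinct        = distinct
    ; ends-in-root    = ends-in-root
    ; entries-in-A    = λ x _ → full-lookup x
    ; #blocks         = trans (count-all (meets full) P every-block-meets) #P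
    }
  open Rebuild k s start k≤n

theorem2p1 : (n : ℕ) → 2 ≤ n → (r : Fin n) → (k : ℕ) → 1 ≤ k → k < n →
    ((T : RTree n r) → InTrees k T → IsPartition r k (phiGlo T) × IsSeq r k (psi T k)) ×
    ((T T′ : RTree n r) → InTrees k T → InTrees k T′ →
      phiGlo T ↭ phiGlo T′ → psi T k ≡ psi T′ k → (v : Fin n) → par T v ≡ par T′ v) ×
    ((P : List (Subset n)) → IsPartition r k P → (s : Vec (Fin n) k) → IsSeq r k s →
      Σ (RTree n r) (λ T → InTrees k T × (phiGlo T ↭ P) × (psi T k ≡ s))) ×
    ((T : RTree n r) → InTrees k T → (i : ℕ) → 1 ≤ i → indegMult T i ≡ typeMult (phiGlo T) i)
theorem2p1 n _ r k _ k<n =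
  (λ T #T → Blocks.phiGlo-partition T k #T , Blocks.psi-sequence T k #T) ,
  injective k ,
  surjective k (ℕP.<⇒≤ k<n) ,
  (λ T _ → Blocks.indegree-type T)
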